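{- Let $F$ be a clause-set with all clauses of length $1$ or $2$, and let $\{x\}\in F$. For $P \in \mathfrak U_x(\mathrm{idg}(F))$ let $F(P) := \mathcal{CL}(E(P)) \cup \{\{x\}\}\subseteq F$. Then: 1. The map $P\mapsto F(P)$ is a surjection from $\mathfrak U_x(\mathrm{idg}(F))$ onto the set $\mathrm{mus}_{\{x\}}(F)$ of minimally unsatisfiable subsets of $F$ containing $\{x\}$. 2. For $F'\in \mathrm{mus}_{\{x\}}(F)$, the preimage $\{P \in \mathfrak U_x(\mathrm{idg}(F)) : F(P)=F'\}$ has exactly one element iff $F'$ contains exactly two unit-clauses (i.e. belongs to Family I). These $F'$ are exactly the $F(P)$ for those $P\in\mathfrak U_x(\mathrm{idg}(F))$ whose final arc is a unit; removing that final arc, which corresponds to the second unit-clause $\{y\}$ of $F'$, yields a regular path from $x$ to $\overline y$. 3. For every $F'\in\mathrm{mus}_{\{x\}}(F)$ containing exactly one unit-clause (namely $\{x\}$) the preimage has exactly two elements; more precisely, let $P\in\mathfrak U_x(\mathrm{idg}(F))$ with $F(P)=F'$: (a) If the last vertex of $P$ is $\overline x$, then $P$ has length at least $2$, $F'$ belongs to Family IIa, $\overline P \neq P$, $\overline P\in\mathfrak U_x(\mathrm{idg}(F))$, $F(\overline P)=F(P)$, and the preimage of $F'$ is $\{P,\overline P\}$. (b) Otherwise $F'$ belongs to Family IIb; with the regular decomposition $P=P_0;P_1$ and $P' := P_0;\overline{P_1}$ we have $P'\ne P$ and the preimage of $F'$ is $\{P,P'\}$.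
   Context: Literals are variables and complements ($\overline{\overline x}=x$); clauses are finite sets of literals without complementary pair; clause-sets are finite sets of clauses. A clause-set is minimally unsatisfiable (MU) if unsatisfiable and removing any one clause makes it satisfiable. $\mathrm{vdeg}_F(v)$ is the number of clauses containing $v$ or $\overline v$. The implication digraph $\mathrm{idg}(F)$ has vertex set all literals whose variable occurs in $F$; each binary clause $\{a,b\}$ yields arcs $(\overline a,b),(\overline b,a)$, and each unit-clause $\{a\}$ yields the arc $(\overline a,a)$; an arc of the form $(a,\overline a)$ is called a unit. For an arc set $A$, $\mathcal{CL}(A)=\{\{\overline a,b\}:(a,b)\in A\}$. Paths have pairwise distinct vertices; a path is regular if its vertex set has no complementary pair. A path is nearly regular if its vertex set contains exactly one complementary pair and the path without its last vertex is regular; $\mathfrak U_x(\mathrm{idg}(F))$ is the set of nearly regular paths starting at $x$. For a nearly regular path $P$ with last vertex $w$, the vertex $\overline w$ occurs on $P$; the regular decomposition $P=P_0;P_1$ splits $P$ at $\overline w$, where $P_0$ is the initial segment ending at $\overline w$ and $P_1$ the segment from $\overline w$ to $w$ (if $\overline w = x$, $P_0$ is trivial and $P_1=P$). For a path $Q$ of length $\ge1$, its contraposition $\overline Q$ replaces each arc $(a,b)$ by $(\overline b,\overline a)$ and reverses the order (a path from the complement of the last vertex of $Q$ to the complement of its first vertex). Family I: MU clause-sets with clauses of length $\le2$ containing exactly two unit-clauses. Family II: those containing exactly one unit-clause $\{z\}$; within it, Family IIa consists of those whose unique variable of degree $\mathrm{vdeg}=3$ is the variable of $z$ (shape: $\{z\}$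 plus an implication chain $z\to\dots\to\overline z$), and Family IIb of the others (shape: $\{z\}$ plus an implication chain $z\to\dots\to y\to\dots\to\overline y$ with $\mathrm{var}(y)\ne\mathrm{var}(z)$ the unique degree-3 variable). -}

module Defs where

open import Data.Nat using (ℕ; _≤_)
open import Data.Bool using (Bool; true; false; not)
open import Data.List using (List; []; _∷_; _++_; _∷ʳ_; map; reverse; length; drop)
open import Data.List.Membership.Propositional using (_∈_; _∉_)
open import Data.List.Relation.Unary.All using (All)
open import Data.List.Relation.Unary.Any using (Any)
open import Data.List.Relation.Unary.AllPairs using (AllPairs)
open import Data.List.Relation.Unary.Linked using (Linked)
open import Data.List.Relation.Unary.Unique.Propositional using (Unique)
open import Data.Product using (Σ; ∃; ∃₂; _×_; _,_; proj₁; proj₂)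
open import Data.Sum using (_⊎_)
open import Relation.Binary.PropositionalEquality using (_≡_; _≢_)
open import Relation.Nullary using (¬_)
open import Function.Bundles using (_⇔_)

data Lit : Set where
  pos : ℕ → Lit
  neg : ℕ → Lit

var : Lit → ℕ
var (pos v) = v
var (neg v) = v

compl : Lit → Lit
compl (pos v) = neg v
compl (neg v) = pos v

-- A clause is a finite set of literals, represented by a list; lists are
-- compared as sets (same members).
Clause : Set
Clause = List Lit

_≐_ : Clause → Clause → Set
C ≐ D = ∀ l → (l ∈ C) ⇔ (l ∈ D)

NoCompPair : Clause → Set
NoCompPair C = ∀ l → l ∈ C → compl l ∉ C

-- A clause-set is a finite set of clauses, represented by a list;
-- membership/inclusion/equality are taken up to set equality of clauses.
ClauseSet : Set
ClauseSet = List Clause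

_∈ᶜ_ : Clause → ClauseSet → Set
C ∈ᶜ F = Any (C ≐_) F

_⊆ᶜ_ : ClauseSet → ClauseSet → Set
F ⊆ᶜ G = ∀ C → C ∈ᶜ F → C ∈ᶜ G

_≐ᶜ_ : ClauseSet → ClauseSet → Set
F ≐ᶜ G = (F ⊆ᶜ G) × (G ⊆ᶜ F)

IsClauseSet : ClauseSet → Set
IsClauseSet F = All NoCompPair F

IsUnit : Clause → Set
IsUnit C = ∃ λ a → C ≐ (a ∷ [])

IsBinary : Clause → Set
IsBinary C = ∃₂ λ a b → a ≢ b × C ≐ (a ∷ b ∷ [])

LenLe2 : Clause → Set
LenLe2 C = ∃ λ ds → length ds ≤ 2 × C ≐ ds

Assignment : Set
Assignment = ℕ → Bool

valLit : Assignment → Lit → Bool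
valLit φ (pos v) = φ v
valLit φ (neg v) = not (φ v)

SatClause : Assignment → Clause → Set
SatClause φ C = Any (λ l → valLit φ l ≡ true) C

Satisfiable : ClauseSet → Set
Satisfiable F = ∃ λ φ → All (SatClause φ) F

Unsat : ClauseSet → Set
Unsat F = ¬ Satisfiable F

IsRemoval : ClauseSet → Clause → ClauseSet → Set
IsRemoval F C G = ∀ D → (D ∈ᶜ G) ⇔ (D ∈ᶜ F × ¬ (D ≐ C))

MU : ClauseSet → Set
MU F = Unsat F × (∀ C → C ∈ᶜ F → ∀ G → IsRemoval F C G → Satisfiable G)

InMus : ClauseSet → Lit → ClauseSet → Set
InMus F x G = G ⊆ᶜ F × MU G × (x ∷ []) ∈ᶜ G

HasVar : ℕ → Clause → Set
HasVar v C = ∃ λ l → l ∈ C × var l ≡ v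

VDeg : ClauseSet → ℕ → ℕ → Set
VDeg F v n = ∃ λ Cs →
    length Cs ≡ n
  × AllPairs (λ C D → ¬ (C ≐ D)) Cs
  × All (λ C → C ∈ᶜ F × HasVar v C) Cs
  × (∀ C → C ∈ᶜ F → HasVar v C → Any (C ≐_) Cs)

OneUnit : ClauseSet → Lit → Set
OneUnit F z = (z ∷ []) ∈ᶜ F × (∀ C → C ∈ᶜ F → IsUnit C → C ≐ (z ∷ []))

UnitsAre : ClauseSet → Lit → Lit → Set
UnitsAre F a b = a ≢ b × (a ∷ []) ∈ᶜ F × (b ∷ []) ∈ᶜ F
  × (∀ C → C ∈ᶜ F → IsUnit C → C ≐ (a ∷ []) ⊎ C ≐ (b ∷ []))

TwoUnits : ClauseSet → Set
TwoUnits F = ∃₂ λ a b → UnitsAre F a b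

Family2CNF-MU : ClauseSet → Set
Family2CNF-MU F = IsClauseSet F × MU F × All LenLe2 F

FamilyI : ClauseSet → Set
FamilyI F = Family2CNF-MU F × TwoUnits F

FamilyII : ClauseSet → Lit → Set
FamilyII F z = Family2CNF-MU F × OneUnit F z

FamilyIIa : ClauseSet → Lit → Set
FamilyIIa F z = FamilyII F z × VDeg F (var z) 3
  × (∀ v → VDeg F v 3 → v ≡ var z)

FamilyIIb : ClauseSet → Lit → Set
FamilyIIb F z = FamilyII F z × ¬ (FamilyIIa F z)

IsVertex : ClauseSet → Lit → Set
IsVertex F l = ∃ λ C → C ∈ᶜ F × HasVar (var l) C

data Arc (F : ClauseSet) : Lit → Lit → Set where
  bin₁ : ∀ a b → a ≢ b → (a ∷ b ∷ []) ∈ᶜ F → Arc F (compl a) b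
  bin₂ : ∀ a b → a ≢ b → (a ∷ b ∷ []) ∈ᶜ F → Arc F (compl b) a
  unit : ∀ a → (a ∷ []) ∈ᶜ F → Arc F (compl a) a

-- A path is given by its (nonempty) list of vertices; since arcs are
-- pairs of vertices, the vertex sequence determines the path.
IsPath : ClauseSet → List Lit → Set
IsPath F vs = vs ≢ [] × All (IsVertex F) vs × Unique vs × Linked (Arc F) vs

StartsAt : Lit → List Lit → Set
StartsAt x vs = ∃ λ r → vs ≡ x ∷ r

Last : List Lit → Lit → Set
Last vs w = ∃ λ ws → vs ≡ ws ∷ʳ w

Regular : List Lit → Set
Regular vs = ∀ l → l ∈ vs → compl l ∉ vs

NearlyRegular : List Lit → Set
NearlyRegular vs =
    (∃ λ l → l ∈ vs × compl l ∈ vs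
       × (∀ m → m ∈ vs → compl m ∈ vs → m ≡ l ⊎ m ≡ compl l))
  × (∃₂ λ ws w → vs ≡ ws ∷ʳ w × Regular ws)

InU : ClauseSet → Lit → List Lit → Set
InU F x vs = IsPath F vs × StartsAt x vs × NearlyRegular vs

arcs : List Lit → List (Lit × Lit)
arcs (a ∷ b ∷ r) = (a , b) ∷ arcs (b ∷ r)
arcs _ = []

CL : List (Lit × Lit) → ClauseSet
CL A = map (λ p → compl (proj₁ p) ∷ proj₂ p ∷ []) A

FP : Lit → List Lit → ClauseSet
FP x P = (x ∷ []) ∷ CL (arcs P)

pathLength : List Lit → ℕ
pathLength [] = 0
pathLength (_ ∷ r) = length r

FinalArcUnit : List Lit → Set
FinalArcUnit P = ∃₂ λ ws a → P ≡ ws ++ (a ∷ compl a ∷ [])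

contra : List Lit → List Lit
contra P = reverse (map compl P)

-- concatenation P;Q of a path P with a path Q starting at the end of P
_⨾_ : List Lit → List Lit → List Lit
P ⨾ Q = P ++ drop 1 Q

RegDecomp : List Lit → List Lit → List Lit → Set
RegDecomp P P0 P1 = ∃ λ w → Last P w × ∃₂ λ ps qs →
  P ≡ ps ++ (compl w ∷ qs) × P0 ≡ ps ∷ʳ compl w × P1 ≡ compl w ∷ qs

InPreimage : ClauseSet → Lit → ClauseSet → List Lit → Set
InPreimage F x F' P = InU F x P × FP x P ≐ᶜ F'

PreimageIsOne : ClauseSet → Lit → ClauseSet → Set
PreimageIsOne F x F' = ∃ λ P → InPreimage F x F' P
  × (∀ Q → InPreimage F x F' Q → Q ≡ P)

PreimageIsPair : ClauseSet → Lit → ClauseSet → List Lit → List Lit → Set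
PreimageIsPair F x F' P Q = ∀ R → InPreimage F x F' R ⇔ (R ≡ P ⊎ R ≡ Q)

PreimageHasTwo : ClauseSet → Lit → ClauseSet → Set
PreimageHasTwo F x F' = ∃₂ λ P Q → P ≢ Q × PreimageIsPair F x F' P Q

Is12ClauseSet : ClauseSet → Set
Is12ClauseSet F = IsClauseSet F × All (λ C → IsUnit C ⊎ IsBinary C) F

-- Write a nearly regular path from x as P = A ++ c ∷ B ∷ʳ c̄, that is P₀ = A ∷ʳ c followed
-- by the loop P₁ = c ∷ B ∷ʳ c̄.  Propagating x along P forces both c and c̄, so F(P) is
-- unsatisfiable; dropping the clause of an arc u → v is repaired by the consistent set of
-- literals that keeps P before the cut and complements P from v up to the next of c, c̄
-- (dropping {x}: complement all of P₀).  Conversely, for a minimally unsatisfiable F′ ∋ {x}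
-- the literals reachable from x in idg(F′) are inconsistent, since otherwise they would
-- extend a model of F′ − {x}; reaching both t and t̄ gives a walk x ⇝ t ⇝ x̄ (contraposing
-- x ⇝ t̄), whose shortest nearly regular prefix P has F(P) ⊆ F′, hence F(P) = F′.
-- In idg(F(P)) every vertex of P other than c and c̄ has a single out-arc, so a path Q with
-- F(Q) = F(P) follows P up to c and then runs through P₁ forwards or contraposed: the
-- preimage is {P , P₀ ; contra P₁}.  The two coincide iff B is empty, i.e. the last arc is
-- the unit c → c̄ and {c̄} is a second unit clause; otherwise var c is the only variable of
-- degree 3 (in the clauses entering c, leaving c and entering c̄), and var c = var x iff P
-- ends in x̄.

module Submission where

open import Defs
open import Data.Nat using (zero; suc; _≥_; s≤s; z≤n)
import Data.Nat as ℕ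
import Data.Nat.Properties as ℕ
open import Data.Bool using (true; false; not)
open import Data.Bool.Properties using (not-involutive)
open import Data.List using (List; []; _∷_; _++_; _∷ʳ_; [_]; map; reverse; length; drop; filter)
open import Data.List.Properties
  using (∷-injective; ++-assoc; ++-identityʳ; map-++; reverse-++; unfold-reverse; ∷ʳ-injective;
         reverse-involutive; reverse-map; ++-conicalʳ; ++-cancelˡ; ++-cancelʳ; length-++)
open import Data.List.Membership.Propositional using (_∈_; _∉_; find; lose)
open import Data.List.Membership.Propositional.Properties
  using (∈-++⁺ˡ; ∈-++⁺ʳ; ∈-++⁻; ∈-map⁺; ∈-map⁻; ∈-∃++; ∈-filter⁺; ∈-filter⁻)
open import Data.List.Relation.Unary.All as All using (All; []; _∷_)
import Data.List.Relation.Unary.All.Properties as All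
open import Data.List.Relation.Unary.Any as Any using (Any; here; there)
import Data.List.Relation.Unary.Any.Properties as Any
open import Data.List.Relation.Unary.AllPairs using ([]; _∷_)
open import Data.List.Relation.Unary.Linked using (Linked; []; [-]; _∷_)
open import Data.List.Relation.Unary.Unique.Propositional using (Unique)
open import Data.List.Relation.Unary.Unique.Propositional.Properties as Unique using (Unique[x∷xs]⇒x∉xs)
open import Data.List.Relation.Binary.Disjoint.Propositional using (Disjoint)
open import Data.List.Relation.Binary.Subset.Propositional using (_⊆_)
open import Data.Product as Product using (∃; ∃₂; _×_; _,_; proj₁; proj₂)
open import Data.Sum as Sum using (_⊎_; inj₁; inj₂)
open import Data.Empty using (⊥-elim)
open import Function.Base using (_∘_; case_of_; flip)
open import Function.Bundles using (_⇔_; mk⇔; Equivalence)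
open import Relation.Binary.Definitions using (DecidableEquality)
open import Relation.Binary.PropositionalEquality
  using (_≡_; _≢_; refl; sym; trans; cong; cong₂; subst; subst₂; module ≡-Reasoning)
open import Relation.Binary.Construct.Closure.ReflexiveTransitive as Star using (Star; ε; _◅_; _◅◅_)
open import Relation.Nullary using (¬_; Dec; yes; no; ¬?)
open import Relation.Nullary.Decidable using (map′; _×-dec_)

open Equivalence using (to; from)

compl-involutive : ∀ l → compl (compl l) ≡ l
compl-involutive (pos v) = refl
compl-involutive (neg v) = refl

compl-injective : ∀ {l m} → compl l ≡ compl m → l ≡ m
compl-injective {l} {m} e = trans (sym (compl-involutive l)) (trans (cong compl e) (compl-involutive m))

compl-≡⇒≡compl : ∀ {l m} → compl l ≡ m → l ≡ compl m
compl-≡⇒≡compl {l} e = trans (sym (compl-involutive l)) (cong compl e)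

compl-≢ : ∀ l → compl l ≢ l
compl-≢ (pos v) ()
compl-≢ (neg v) ()

var-compl : ∀ l → var (compl l) ≡ var l
var-compl (pos v) = refl
var-compl (neg v) = refl

var-≡⇒≡⊎≡compl : ∀ l m → var l ≡ var m → l ≡ m ⊎ l ≡ compl m
var-≡⇒≡⊎≡compl (pos v) (pos .v) refl = inj₁ refl
var-≡⇒≡⊎≡compl (pos v) (neg .v) refl = inj₂ refl
var-≡⇒≡⊎≡compl (neg v) (pos .v) refl = inj₂ refl
var-≡⇒≡⊎≡compl (neg v) (neg .v) refl = inj₁ refl

_≟ˡ_ : DecidableEquality Lit
pos v ≟ˡ pos w = map′ (cong pos) (λ { refl → refl }) (v ℕ.≟ w)
pos v ≟ˡ neg w = no λ ()
neg v ≟ˡ pos w = no λ ()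
neg v ≟ˡ neg w = map′ (cong neg) (λ { refl → refl }) (v ℕ.≟ w)

valLit-compl : ∀ φ l → valLit φ (compl l) ≡ not (valLit φ l)
valLit-compl φ (pos v) = refl
valLit-compl φ (neg v) = sym (not-involutive (φ v))

open import Data.List.Membership.DecPropositional _≟ˡ_ using (_∈?_)
open import Data.List.Relation.Binary.Subset.DecPropositional _≟ˡ_ using (_⊆?_)

module _ {A : Set} where

  private
    variable
      a : A
      xs : List A

  ∈-∷ʳ : ∀ (xs : List A) {a} → a ∈ xs ∷ʳ a
  ∈-∷ʳ xs = ∈-++⁺ʳ xs (here refl)

  ∈-∷ʳ⁻ : ∀ (xs : List A) {a b} → a ∈ xs ∷ʳ b → a ∈ xs ⊎ a ≡ b
  ∈-∷ʳ⁻ xs p with ∈-++⁻ xs p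
  ... | inj₁ q = inj₁ q
  ... | inj₂ (here e) = inj₂ e

  ≢[]⇒∈ : {xs : List A} → xs ≢ [] → ∃ λ x → x ∈ xs
  ≢[]⇒∈ {xs = []} xs≢[] = ⊥-elim (xs≢[] refl)
  ≢[]⇒∈ {xs = x ∷ _} _ = x , here refl

  ++-∷≢[] : ∀ (xs : List A) {a ys} → xs ++ a ∷ ys ≢ []
  ++-∷≢[] [] ()
  ++-∷≢[] (_ ∷ _) ()

  ∈-last-suffix : ∀ (xs : List A) {y ys zs z} → xs ++ y ∷ ys ≡ zs ∷ʳ z → z ∈ y ∷ ys
  ∈-last-suffix [] {zs = zs} e = subst (_ ∈_) (sym e) (∈-∷ʳ zs)
  ∈-last-suffix (x ∷ xs) {zs = []} e = ⊥-elim (++-∷≢[] xs (proj₂ (∷-injective e)))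
  ∈-last-suffix (x ∷ xs) {zs = _ ∷ zs} e = ∈-last-suffix xs (proj₂ (∷-injective e))

  ∈-prefix : ∀ (xs : List A) {y ys zs z} → xs ++ y ∷ ys ≡ zs ∷ʳ z → xs ⊆ zs
  ∈-prefix (x ∷ xs) {zs = []} e = ⊥-elim (++-∷≢[] xs (proj₂ (∷-injective e)))
  ∈-prefix (x ∷ xs) {zs = _ ∷ zs} e (here refl) = here (proj₁ (∷-injective e))
  ∈-prefix (x ∷ xs) {zs = _ ∷ zs} e (there p) = there (∈-prefix xs (proj₂ (∷-injective e)) p)

  ∷ʳ-as-∷ : ∀ (xs : List A) y → ∃₂ λ z zs → xs ∷ʳ y ≡ z ∷ zs
  ∷ʳ-as-∷ [] y = y , [] , refl
  ∷ʳ-as-∷ (x ∷ xs) y = x , xs ∷ʳ y , refl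

  ∷ʳ-head : ∀ (xs : List A) {y z zs} → xs ∷ʳ y ≡ z ∷ zs → xs ≡ [] ⊎ z ∈ xs
  ∷ʳ-head [] _ = inj₁ refl
  ∷ʳ-head (x ∷ xs) e = inj₂ (here (sym (proj₁ (∷-injective e))))

  ∷-as-∷ʳ : ∀ (y : A) ys → ∃₂ λ zs z → y ∷ ys ≡ zs ∷ʳ z
  ∷-as-∷ʳ y [] = [] , y , refl
  ∷-as-∷ʳ y (y′ ∷ ys) with ∷-as-∷ʳ y′ ys
  ... | zs , z , e = y ∷ zs , z , cong (y ∷_) e

  []⊎∷ʳ : ∀ (xs : List A) → xs ≡ [] ⊎ ∃₂ λ ys y → xs ≡ ys ∷ʳ y
  []⊎∷ʳ [] = inj₁ refl
  []⊎∷ʳ (x ∷ xs) = inj₂ (∷-as-∷ʳ x xs)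

  ≡[]⊎≢[] : ∀ (xs : List A) → xs ≡ [] ⊎ xs ≢ []
  ≡[]⊎≢[] [] = inj₁ refl
  ≡[]⊎≢[] (_ ∷ _) = inj₂ λ ()

  length-∷ʳ≥2 : ∀ {xs : List A} {y} → xs ≢ [] → length (xs ∷ʳ y) ≥ 2
  length-∷ʳ≥2 {xs = []} xs≢[] = ⊥-elim (xs≢[] refl)
  length-∷ʳ≥2 {xs = _ ∷ []} _ = s≤s (s≤s z≤n)
  length-∷ʳ≥2 {xs = _ ∷ _ ∷ _} _ = s≤s (s≤s z≤n)

  Unique-∷⁺ : a ∉ xs → Unique xs → Unique (a ∷ xs)
  Unique-∷⁺ a∉ u = All.¬Any⇒All¬ _ a∉ ∷ u

  Unique-++⁻ˡ : ∀ (xs : List A) {ys} → Unique (xs ++ ys) → Unique xs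
  Unique-++⁻ˡ [] _ = []
  Unique-++⁻ˡ (x ∷ xs) (px ∷ u) = All.++⁻ˡ xs px ∷ Unique-++⁻ˡ xs u

  Unique-++⁻ʳ : ∀ (xs : List A) {ys} → Unique (xs ++ ys) → Unique ys
  Unique-++⁻ʳ [] u = u
  Unique-++⁻ʳ (x ∷ xs) (_ ∷ u) = Unique-++⁻ʳ xs u

  Unique-++⇒Disjoint : ∀ (xs : List A) {ys} → Unique (xs ++ ys) → Disjoint xs ys
  Unique-++⇒Disjoint (x ∷ xs) (px ∷ u) (here refl , q) = All.lookup (All.++⁻ʳ xs px) q refl
  Unique-++⇒Disjoint (x ∷ xs) (_ ∷ u) (there p , q) = Unique-++⇒Disjoint xs u (p , q)

  Unique-middle-Disjoint : ∀ (L Y Z : List A) → Unique (L ++ Y ++ Z) → Disjoint (L ++ Z) Y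
  Unique-middle-Disjoint L Y Z u (p , q) with ∈-++⁻ L p
  ... | inj₁ p′ = Unique-++⇒Disjoint L u (p′ , ∈-++⁺ˡ q)
  ... | inj₂ p′ = Unique-++⇒Disjoint Y (Unique-++⁻ʳ L u) (q , p′)

  Unique-∷ʳ⁺ : Unique xs → a ∉ xs → Unique (xs ∷ʳ a)
  Unique-∷ʳ⁺ u a∉ = Unique.++⁺ u ([] ∷ []) λ { (p , here refl) → a∉ p }

  Unique-reverse⁺ : Unique xs → Unique (reverse xs)
  Unique-reverse⁺ {[]} u = u
  Unique-reverse⁺ {x ∷ xs} u@(_ ∷ u′) = subst Unique (sym (unfold-reverse x xs))
    (Unique-∷ʳ⁺ (Unique-reverse⁺ u′) (λ p → Unique[x∷xs]⇒x∉xs u (Any.reverse⁻ p)))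

  Unique-split-injective : ∀ (xs ys xs′ ys′ : List A) {a} → Unique (xs ++ a ∷ ys) →
    xs ++ a ∷ ys ≡ xs′ ++ a ∷ ys′ → xs ≡ xs′ × ys ≡ ys′
  Unique-split-injective [] ys [] ys′ u refl = refl , refl
  Unique-split-injective [] ys (x′ ∷ xs′) ys′ u refl = ⊥-elim (Unique[x∷xs]⇒x∉xs u (∈-++⁺ʳ xs′ (here refl)))
  Unique-split-injective (x ∷ xs) ys [] ys′ u refl = ⊥-elim (Unique[x∷xs]⇒x∉xs u (∈-++⁺ʳ xs (here refl)))
  Unique-split-injective (x ∷ xs) ys (x′ ∷ xs′) ys′ (_ ∷ u) e with ∷-injective e
  ... | refl , e′ with Unique-split-injective xs ys xs′ ys′ u e′
  ... | refl , refl = refl , refl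

module _ {A : Set} where

  private
    variable
      a b t u v w : A
      L X Y : List A

  Adj : List A → A → A → Set
  Adj L a b = ∃₂ λ X Y → L ≡ X ++ a ∷ b ∷ Y

  Junction : List A → List A → A → A → Set
  Junction X Y a b = (∃ λ X′ → X ≡ X′ ∷ʳ a) × (∃ λ Y′ → Y ≡ b ∷ Y′)

  Adj-∷⁺ : Adj Y u v → Adj (w ∷ Y) u v
  Adj-∷⁺ {w = w} (X , Y , refl) = w ∷ X , Y , refl

  Adj⇒∈ : Adj X u v → u ∈ X × v ∈ X
  Adj⇒∈ (X , Y , refl) = ∈-++⁺ʳ X (here refl) , ∈-++⁺ʳ X (there (here refl))

  Adj-++⁺ˡ : ∀ Z → Adj X u v → Adj (X ++ Z) u v
  Adj-++⁺ˡ {u = u} {v} Z (X , Y , refl) = X , Y ++ Z , ++-assoc X (u ∷ v ∷ Y) Z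

  Adj-++⁺ʳ : ∀ Z → Adj X u v → Adj (Z ++ X) u v
  Adj-++⁺ʳ {u = u} {v} Z (X , Y , refl) = Z ++ X , Y , sym (++-assoc Z X (u ∷ v ∷ Y))

  Junction⇒Adj : Junction X Y u v → Adj (X ++ Y) u v
  Junction⇒Adj {u = u} {v} ((X′ , refl) , (Y′ , refl)) = X′ , Y′ , ++-assoc X′ [ u ] (v ∷ Y′)

  Adj-++⁻ : ∀ X → Adj (X ++ Y) u v → Adj X u v ⊎ Adj Y u v ⊎ Junction X Y u v
  Adj-++⁻ [] adj = inj₂ (inj₁ adj)
  Adj-++⁻ (x ∷ []) ([] , Y₁ , refl) = inj₂ (inj₂ (([] , refl) , (Y₁ , refl)))
  Adj-++⁻ (x ∷ x′ ∷ X) ([] , Y₁ , e) with ∷-injective e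
  ... | refl , e′ with ∷-injective e′
  ... | refl , _ = inj₁ ([] , X , refl)
  Adj-++⁻ (x ∷ X) (_ ∷ X₁ , Y₁ , e) with Adj-++⁻ X (X₁ , Y₁ , proj₂ (∷-injective e))
  ... | inj₁ adj = inj₁ (Adj-∷⁺ adj)
  ... | inj₂ (inj₁ adj) = inj₂ (inj₁ adj)
  ... | inj₂ (inj₂ ((X′ , refl) , j)) = inj₂ (inj₂ ((x ∷ X′ , refl) , j))

  Adj-[-] : ¬ Adj (w ∷ []) u v
  Adj-[-] ([] , Y , ())
  Adj-[-] (_ ∷ X , Y , e) with ++-conicalʳ X _ (sym (proj₂ (∷-injective e)))
  ... | ()

  Adj-last : ∀ X → Adj ((X ∷ʳ u) ∷ʳ v) u v
  Adj-last {u = u} {v} X = X , [] , ++-assoc X [ u ] [ v ]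

  Adj-∷ʳ⁻ : Adj (X ∷ʳ w) u v → u ∈ X
  Adj-∷ʳ⁻ {X = X} {w} (X₁ , Y₁ , e) with Adj-++⁻ X (X₁ , Y₁ , e)
  ... | inj₁ adj = proj₁ (Adj⇒∈ adj)
  ... | inj₂ (inj₁ adj) = ⊥-elim (Adj-[-] adj)
  ... | inj₂ (inj₂ ((X′ , refl) , _)) = ∈-∷ʳ X′

  Adj-head⁻ : Unique (t ∷ X) → ¬ Adj (t ∷ X) u t
  Adj-head⁻ u ([] , Y , refl) = Unique[x∷xs]⇒x∉xs u (here refl)
  Adj-head⁻ u (x ∷ X , Y , refl) = Unique[x∷xs]⇒x∉xs u (∈-++⁺ʳ X (there (here refl)))

  Unique⇒Adj-functional : Unique X → Adj X u v → Adj X u w → v ≡ w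
  Unique⇒Adj-functional {v = v} {w} u (X , Y , refl) (X′ , Y′ , e) =
    proj₁ (∷-injective (proj₂ (Unique-split-injective X (v ∷ Y) X′ (w ∷ Y′) u e)))

  Unique⇒Adj-injective : Unique X → Adj X u w → Adj X v w → u ≡ v
  Unique⇒Adj-injective {u = u} {w} {v} uX (X , Y , refl) (X′ , Y′ , e) =
    proj₂ (∷ʳ-injective X X′ (proj₁ (Unique-split-injective (X ∷ʳ u) Y (X′ ∷ʳ v) Y′ uX′ e′)))
    where
    shift : ∀ Z t (W : List A) → Z ++ t ∷ w ∷ W ≡ (Z ∷ʳ t) ++ w ∷ W
    shift Z t W = sym (++-assoc Z [ t ] (w ∷ W))
    uX′ : Unique ((X ∷ʳ u) ++ w ∷ Y)
    uX′ = subst Unique (shift X u Y) uX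
    e′ : (X ∷ʳ u) ++ w ∷ Y ≡ (X′ ∷ʳ v) ++ w ∷ Y′
    e′ = trans (sym (shift X u Y)) (trans e (shift X′ v Y′))

  Linked⇒Adj : {R : A → A → Set} → Linked R X → Adj X u v → R u v
  Linked⇒Adj (r ∷ _) ([] , Y , refl) = r
  Linked⇒Adj (_ ∷ lk) (_ ∷ X , Y , e) = Linked⇒Adj lk (X , Y , proj₂ (∷-injective e))
  Linked⇒Adj [-] adj = ⊥-elim (Adj-[-] adj)

  Adj⇒Linked : {R : A → A → Set} → ∀ X → (∀ {u v} → Adj X u v → R u v) → Linked R X
  Adj⇒Linked [] f = []
  Adj⇒Linked (_ ∷ []) f = [-]
  Adj⇒Linked (_ ∷ y ∷ X) f = f ([] , X , refl) ∷ Adj⇒Linked (y ∷ X) (f ∘ Adj-∷⁺)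

  Adj-map⁺ : ∀ (f : A → A) {L a b} → Adj L a b → Adj (map f L) (f a) (f b)
  Adj-map⁺ f {a = a} {b} (X , Y , refl) = map f X , map f Y , map-++ f X (a ∷ b ∷ Y)

  Adj-reverse⁺ : Adj L a b → Adj (reverse L) b a
  Adj-reverse⁺ {a = a} {b} (X , Y , refl) = reverse Y , reverse X , (begin
    reverse (X ++ a ∷ b ∷ Y)               ≡⟨ reverse-++ X (a ∷ b ∷ Y) ⟩
    reverse (a ∷ b ∷ Y) ++ reverse X       ≡⟨ cong (_++ reverse X) (reverse-++ (a ∷ b ∷ []) Y) ⟩
    (reverse Y ++ b ∷ a ∷ []) ++ reverse X ≡⟨ ++-assoc (reverse Y) (b ∷ a ∷ []) (reverse X) ⟩
    reverse Y ++ b ∷ a ∷ reverse X         ∎)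
    where open ≡-Reasoning

private
  variable
    a b l m s t u v w x : Lit
    xs ys L P Q ws : List Lit
    C D E : Clause
    F F′ G H : ClauseSet
    φ : Assignment

∈-map-compl⁻ : a ∈ map compl xs → compl a ∈ xs
∈-map-compl⁻ p with ∈-map⁻ compl p
... | y , y∈ , refl = subst (_∈ _) (sym (compl-involutive y)) y∈

∈-contra⁻ : a ∈ contra xs → compl a ∈ xs
∈-contra⁻ p = ∈-map-compl⁻ (Any.reverse⁻ p)

contra-involutive : ∀ xs → contra (contra xs) ≡ xs
contra-involutive xs = begin
  reverse (map compl (reverse (map compl xs))) ≡⟨ cong reverse (reverse-map compl (map compl xs)) ⟩
  reverse (reverse (map compl (map compl xs))) ≡⟨ reverse-involutive _ ⟩
  map compl (map compl xs)                     ≡⟨ map-compl-involutive xs ⟩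
  xs                                           ∎
  where
  open ≡-Reasoning
  map-compl-involutive : ∀ xs → map compl (map compl xs) ≡ xs
  map-compl-involutive [] = refl
  map-compl-involutive (l ∷ xs) = cong₂ _∷_ (compl-involutive l) (map-compl-involutive xs)

contra-∷ : ∀ b xs → contra (b ∷ xs) ≡ contra xs ∷ʳ compl b
contra-∷ b xs = unfold-reverse (compl b) (map compl xs)

contra-∷ʳ : ∀ xs b → contra (xs ∷ʳ b) ≡ compl b ∷ contra xs
contra-∷ʳ xs b = trans (cong reverse (map-++ compl xs [ b ])) (reverse-++ (map compl xs) [ compl b ])

contra-∷-∷ʳ : ∀ c xs → contra (c ∷ (xs ∷ʳ compl c)) ≡ c ∷ (contra xs ∷ʳ compl c)
contra-∷-∷ʳ c xs = begin
  contra (c ∷ (xs ∷ʳ compl c))        ≡⟨ contra-∷ c (xs ∷ʳ compl c) ⟩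
  contra (xs ∷ʳ compl c) ∷ʳ compl c   ≡⟨ cong (_∷ʳ compl c) (contra-∷ʳ xs (compl c)) ⟩
  compl (compl c) ∷ contra xs ∷ʳ compl c ≡⟨ cong (λ z → z ∷ contra xs ∷ʳ compl c) (compl-involutive c) ⟩
  c ∷ (contra xs ∷ʳ compl c)          ∎
  where open ≡-Reasoning

Unique-contra⁺ : Unique xs → Unique (contra xs)
Unique-contra⁺ u = Unique-reverse⁺ (Unique.map⁺ compl-injective u)

Adj-contra⁺ : Adj L a b → Adj (contra L) (compl b) (compl a)
Adj-contra⁺ = Adj-reverse⁺ ∘ Adj-map⁺ compl

Adj-contra⁻ : Adj (contra L) a b → Adj L (compl b) (compl a)
Adj-contra⁻ {L} {a} {b} adj = subst (λ K → Adj K (compl b) (compl a)) (contra-involutive L) (Adj-contra⁺ adj)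

∈arcs⇒Adj : ∀ L → (a , b) ∈ arcs L → Adj L a b
∈arcs⇒Adj (l ∷ m ∷ L) (here refl) = [] , L , refl
∈arcs⇒Adj (l ∷ m ∷ L) (there p) = Adj-∷⁺ (∈arcs⇒Adj (m ∷ L) p)

Adj⇒∈arcs : ∀ L → Adj L a b → (a , b) ∈ arcs L
Adj⇒∈arcs L ([] , Y , refl) = here refl
Adj⇒∈arcs L (x ∷ [] , Y , refl) = there (Adj⇒∈arcs _ ([] , Y , refl))
Adj⇒∈arcs L (x ∷ x′ ∷ X , Y , refl) = there (Adj⇒∈arcs _ (x′ ∷ X , Y , refl))

OnlyComplPair : List Lit → Lit → Set
OnlyComplPair P c = ∀ m → m ∈ P → compl m ∈ P → m ≡ c ⊎ m ≡ compl c

Regular-⊆ : xs ⊆ ys → Regular ys → Regular xs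
Regular-⊆ xs⊆ys r l p q = r l (xs⊆ys p) (xs⊆ys q)

Regular-∷ʳ⁺ : Regular xs → compl a ∉ xs → Regular (xs ∷ʳ a)
Regular-∷ʳ⁺ {xs} r ca∉ l p q with ∈-∷ʳ⁻ xs p | ∈-∷ʳ⁻ xs q
... | inj₁ p′ | inj₁ q′ = r l p′ q′
... | inj₁ p′ | inj₂ refl = ca∉ (subst (_∈ xs) (sym (compl-involutive l)) p′)
... | inj₂ refl | inj₁ q′ = ca∉ q′
... | inj₂ refl | inj₂ e = compl-≢ l e

Regular-sub : ∀ {c} → OnlyComplPair P c → L ⊆ P → c ∉ L ⊎ compl c ∉ L → Regular L
Regular-sub {L = L} {c = c} only L⊆P omits t p q with only t (L⊆P p) (L⊆P q) | omits
... | inj₁ refl | inj₁ c∉ = c∉ p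
... | inj₁ refl | inj₂ c̄∉ = c̄∉ q
... | inj₂ refl | inj₁ c∉ = c∉ (subst (_∈ L) (compl-involutive c) q)
... | inj₂ refl | inj₂ c̄∉ = c̄∉ p

∈-flip⁻ : ∀ L Y Z → a ∈ L ++ map compl Y ++ Z → a ∈ L ++ Z ⊎ compl a ∈ Y
∈-flip⁻ L Y Z p with ∈-++⁻ L p
... | inj₁ p′ = inj₁ (∈-++⁺ˡ p′)
... | inj₂ p′ with ∈-++⁻ (map compl Y) p′
... | inj₁ p″ = inj₂ (∈-map-compl⁻ p″)
... | inj₂ p″ = inj₁ (∈-++⁺ʳ L p″)

Regular-flip : ∀ L Y Z → Disjoint (L ++ Z) Y → Regular (L ++ Z) → Regular Y →
  Regular (L ++ map compl Y ++ Z)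
Regular-flip L Y Z disj rLZ rY t p q with ∈-flip⁻ L Y Z p | ∈-flip⁻ L Y Z q
... | inj₁ p′ | inj₁ q′ = rLZ t p′ q′
... | inj₁ p′ | inj₂ q′ = disj (p′ , subst (_∈ Y) (compl-involutive t) q′)
... | inj₂ p′ | inj₁ q′ = disj (q′ , p′)
... | inj₂ p′ | inj₂ q′ = rY (compl t) p′ q′

Regular-flip-separating : ∀ {c} L Y Z → Unique (L ++ Y ++ Z) → OnlyComplPair (L ++ Y ++ Z) c →
  (c ∈ Y × compl c ∈ L ++ Z) ⊎ (compl c ∈ Y × c ∈ L ++ Z) → Regular (L ++ map compl Y ++ Z)
Regular-flip-separating {c} L Y Z u only sep =
  Regular-flip L Y Z disj (Regular-sub only LZ⊆ (proj₁ omits)) (Regular-sub only Y⊆ (proj₂ omits))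
  where
  disj : Disjoint (L ++ Z) Y
  disj = Unique-middle-Disjoint L Y Z u
  LZ⊆ : L ++ Z ⊆ L ++ Y ++ Z
  LZ⊆ p with ∈-++⁻ L p
  ... | inj₁ p′ = ∈-++⁺ˡ p′
  ... | inj₂ p′ = ∈-++⁺ʳ L (∈-++⁺ʳ Y p′)
  Y⊆ : Y ⊆ L ++ Y ++ Z
  Y⊆ = ∈-++⁺ʳ L ∘ ∈-++⁺ˡ
  omits : (c ∉ L ++ Z ⊎ compl c ∉ L ++ Z) × (c ∉ Y ⊎ compl c ∉ Y)
  omits = case sep of λ where
    (inj₁ (c∈Y , c̄∈LZ)) → inj₁ (λ c∈LZ → disj (c∈LZ , c∈Y)) , inj₂ (λ c̄∈Y → disj (c̄∈LZ , c̄∈Y))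
    (inj₂ (c̄∈Y , c∈LZ)) → inj₂ (λ c̄∈LZ → disj (c̄∈LZ , c̄∈Y)) , inj₁ (λ c∈Y → disj (c∈LZ , c∈Y))

≐-refl : C ≐ C
≐-refl l = mk⇔ (λ p → p) (λ p → p)

≐-sym : C ≐ D → D ≐ C
≐-sym e l = mk⇔ (from (e l)) (to (e l))

≐-trans : C ≐ D → D ≐ E → C ≐ E
≐-trans e f l = mk⇔ (to (f l) ∘ to (e l)) (from (e l) ∘ from (f l))

∈ᶜ-resp-≐ : C ≐ D → C ∈ᶜ F → D ∈ᶜ F
∈ᶜ-resp-≐ e = Any.map (≐-trans (≐-sym e))

∈⇒∈ᶜ : C ∈ F → C ∈ᶜ F
∈⇒∈ᶜ = Any.map λ { refl → ≐-refl }

≐ᶜ-sym : F ≐ᶜ G → G ≐ᶜ F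
≐ᶜ-sym (f , g) = g , f

≐ᶜ-trans : F ≐ᶜ G → G ≐ᶜ H → F ≐ᶜ H
≐ᶜ-trans (f , g) (f′ , g′) = (λ C → f′ C ∘ f C) , (λ C → g C ∘ g′ C)

∈-[-]⁻ : l ∈ a ∷ [] → l ≡ a
∈-[-]⁻ (here e) = e

∈-pair⁻ : l ∈ a ∷ b ∷ [] → l ≡ a ⊎ l ≡ b
∈-pair⁻ (here e) = inj₁ e
∈-pair⁻ (there (here e)) = inj₂ e

[-]≐[-]⁻ : (a ∷ []) ≐ (b ∷ []) → a ≡ b
[-]≐[-]⁻ e = ∈-[-]⁻ (to (e _) (here refl))

pair≐[-]⁻ : (a ∷ b ∷ []) ≐ (l ∷ []) → a ≡ l × b ≡ l
pair≐[-]⁻ e = ∈-[-]⁻ (to (e _) (here refl)) , ∈-[-]⁻ (to (e _) (there (here refl)))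

pair≐pair⁻ : (a ∷ b ∷ []) ≐ (l ∷ m ∷ []) → (a ≡ l × b ≡ m) ⊎ (a ≡ m × b ≡ l)
pair≐pair⁻ {a} {b} {l} {m} e
  with ∈-pair⁻ (to (e a) (here refl)) | ∈-pair⁻ (to (e b) (there (here refl)))
     | ∈-pair⁻ (from (e l) (here refl)) | ∈-pair⁻ (from (e m) (there (here refl)))
... | inj₁ refl | inj₂ refl | _ | _ = inj₁ (refl , refl)
... | inj₂ refl | inj₁ refl | _ | _ = inj₂ (refl , refl)
... | inj₁ refl | inj₁ refl | _ | inj₁ refl = inj₁ (refl , refl)
... | inj₁ refl | inj₁ refl | _ | inj₂ refl = inj₁ (refl , refl)
... | inj₂ refl | inj₂ refl | inj₁ refl | _ = inj₂ (refl , refl)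
... | inj₂ refl | inj₂ refl | inj₂ refl | _ = inj₂ (refl , refl)

pair-≡⇒≐ : a ≡ l → b ≡ m → (a ∷ b ∷ []) ≐ (l ∷ m ∷ [])
pair-≡⇒≐ refl refl = ≐-refl

pair-swap : (a ∷ b ∷ []) ≐ (b ∷ a ∷ [])
pair-swap l = mk⇔ swap swap
  where
  swap : ∀ {a b} → l ∈ a ∷ b ∷ [] → l ∈ b ∷ a ∷ []
  swap (here e) = there (here e)
  swap (there (here e)) = here e

pair-dup : (a ∷ a ∷ []) ≐ (a ∷ [])
pair-dup l = mk⇔ (λ { (here e) → here e ; (there (here e)) → here e }) there′
  where
  there′ : ∀ {a} → l ∈ a ∷ [] → l ∈ a ∷ a ∷ []
  there′ (here e) = here e

⊆×⊇⇒≐ : C ⊆ D × D ⊆ C → C ≐ D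
⊆×⊇⇒≐ (f , g) l = mk⇔ f g

_≐?_ : (C D : Clause) → Dec (C ≐ D)
C ≐? D = map′ ⊆×⊇⇒≐ (λ e → to (e _) , from (e _)) (C ⊆? D ×-dec D ⊆? C)

_∈ᶜ?_ : (C : Clause) (F : ClauseSet) → Dec (C ∈ᶜ F)
C ∈ᶜ? F = Any.any? (C ≐?_) F

remove : Clause → ClauseSet → ClauseSet
remove C = filter (λ D → ¬? (D ≐? C))

remove-isRemoval : ∀ C F → IsRemoval F C (remove C F)
remove-isRemoval C F D = mk⇔ out into
  where
  out : D ∈ᶜ remove C F → D ∈ᶜ F × ¬ (D ≐ C)
  out p with find p
  ... | E , E∈ , e with ∈-filter⁻ (λ D → ¬? (D ≐? C)) {xs = F} E∈
  ... | E∈F , E≉C = ∈ᶜ-resp-≐ (≐-sym e) (∈⇒∈ᶜ E∈F) , λ e′ → E≉C (≐-trans (≐-sym e) e′)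
  into : D ∈ᶜ F × ¬ (D ≐ C) → D ∈ᶜ remove C F
  into (p , D≉C) with find p
  ... | E , E∈ , e = ∈ᶜ-resp-≐ (≐-sym e) (∈⇒∈ᶜ (∈-filter⁺ (λ D → ¬? (D ≐? C)) E∈ (λ e′ → D≉C (≐-trans e e′))))

Any-resp-≐ : {Q : Lit → Set} → C ≐ D → Any Q C → Any Q D
Any-resp-≐ e q with find q
... | l , l∈ , ql = lose (to (e l) l∈) ql

All-SatClause-∈ᶜ : All (SatClause φ) F → C ∈ᶜ F → SatClause φ C
All-SatClause-∈ᶜ sat p with find p
... | E , E∈F , e = Any-resp-≐ (≐-sym e) (All.lookup sat E∈F)

All-SatClause-⊆ᶜ : G ⊆ᶜ F → All (SatClause φ) F → All (SatClause φ) G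
All-SatClause-⊆ᶜ G⊆F sat = All.tabulate λ D∈G → All-SatClause-∈ᶜ sat (G⊆F _ (∈⇒∈ᶜ D∈G))

MU-⊆ᶜ : MU F → G ⊆ᶜ F → Unsat G → F ⊆ᶜ G
MU-⊆ᶜ {F} {G} (_ , minimal) G⊆F unsatG C C∈F with C ∈ᶜ? G
... | yes C∈G = C∈G
... | no C∉G with minimal C C∈F (remove C F) (remove-isRemoval C F)
... | φ , sat = ⊥-elim (unsatG (φ , All-SatClause-⊆ᶜ G⊆F-C sat))
  where
  G⊆F-C : G ⊆ᶜ remove C F
  G⊆F-C D D∈G = from (remove-isRemoval C F D) (G⊆F D D∈G , λ e → C∉G (∈ᶜ-resp-≐ e D∈G))

override : List Lit → Assignment → Assignment
override T φ v with pos v ∈? T | neg v ∈? T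
... | yes _ | _ = true
... | no _ | yes _ = false
... | no _ | no _ = φ v

override-∈ : ∀ {T} → Regular T → l ∈ T → valLit (override T φ) l ≡ true
override-∈ {pos v} {T = T} r l∈ with pos v ∈? T
... | yes _ = refl
... | no l∉ = ⊥-elim (l∉ l∈)
override-∈ {neg v} {T = T} r l∈ with pos v ∈? T | neg v ∈? T
... | yes p | _ = ⊥-elim (r (neg v) l∈ p)
... | no _ | yes _ = refl
... | no _ | no l∉ = ⊥-elim (l∉ l∈)

override-∉ : ∀ {T} → l ∉ T → compl l ∉ T → valLit (override T φ) l ≡ valLit φ l
override-∉ {pos v} {T = T} l∉ l̄∉ with pos v ∈? T | neg v ∈? T
... | yes p | _ = ⊥-elim (l∉ p)
... | no _ | yes p = ⊥-elim (l̄∉ p)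
... | no _ | no _ = refl
override-∉ {neg v} {T = T} l∉ l̄∉ with pos v ∈? T | neg v ∈? T
... | yes p | _ = ⊥-elim (l̄∉ p)
... | no _ | yes p = ⊥-elim (l∉ p)
... | no _ | no _ = refl

Regular⇒Satisfiable : ∀ {T} → Regular T → All (Any (_∈ T)) G → Satisfiable G
Regular⇒Satisfiable {T = T} r hits = override T (λ _ → true) , All.map (Any.map (override-∈ r)) hits

valLit-consistent : valLit φ l ≡ true → valLit φ (compl l) ≢ true
valLit-consistent {φ} {l} vl vl̄ with trans (trans (sym vl̄) (valLit-compl φ l)) (cong not vl)
... | ()

cl : Lit → Lit → Clause
cl a b = compl a ∷ b ∷ []

modus-ponens : SatClause φ (cl a b) → valLit φ a ≡ true → valLit φ b ≡ true
modus-ponens {a = a} (here e) va = ⊥-elim (valLit-consistent {l = a} va e)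
modus-ponens (there (here e)) _ = e

true-along-path : ∀ {φ} L → StartsAt x L → valLit φ x ≡ true →
  (∀ {a b} → Adj L a b → valLit φ a ≡ true → valLit φ b ≡ true) →
  ∀ {l} → l ∈ L → valLit φ l ≡ true
true-along-path (_ ∷ L) (_ , refl) vx step (here refl) = vx
true-along-path (_ ∷ m ∷ L) (_ , refl) vx step (there l∈) =
  true-along-path (m ∷ L) (L , refl) (step ([] , L , refl) vx) (step ∘ Adj-∷⁺) l∈

-- Nearly regular paths and the clause-set F(P)

FP-∈⁻ : C ∈ᶜ FP x P → C ≐ (x ∷ []) ⊎ ∃₂ λ a b → Adj P a b × C ≐ cl a b
FP-∈⁻ (here e) = inj₁ e
FP-∈⁻ {P = P} (there p) with find (Any.map⁻ p)
... | (a , b) , ab∈ , e = inj₂ (a , b , ∈arcs⇒Adj P ab∈ , e)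

x∈ᶜFP : (x ∷ []) ∈ᶜ FP x P
x∈ᶜFP = here ≐-refl

FP-∈⁺ : Adj P a b → cl a b ∈ᶜ FP x P
FP-∈⁺ {P = P} adj = there (Any.map⁺ (lose (Adj⇒∈arcs P adj) ≐-refl))

FP-⊆ᶜ : (x ∷ []) ∈ᶜ G → (∀ {a b} → Adj P a b → cl a b ∈ᶜ G) → FP x P ⊆ᶜ G
FP-⊆ᶜ x∈G arcs⊆G C p with FP-∈⁻ p
... | inj₁ e = ∈ᶜ-resp-≐ (≐-sym e) x∈G
... | inj₂ (a , b , adj , e) = ∈ᶜ-resp-≐ (≐-sym e) (arcs⊆G adj)

FP-arc⁻ : cl a v ∈ᶜ FP x P → compl a ≢ x → Adj P a v ⊎ Adj P (compl v) (compl a)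
FP-arc⁻ p ā≢x with FP-∈⁻ p
... | inj₁ e = ⊥-elim (ā≢x (proj₁ (pair≐[-]⁻ e)))
... | inj₂ (a′ , b′ , adj , e) with pair≐pair⁻ e
... | inj₁ (e₁ , refl) = inj₁ (subst (λ a → Adj _ a _) (sym (compl-injective e₁)) adj)
... | inj₂ (refl , refl) = inj₂ (subst (λ a → Adj _ a _) (sym (compl-involutive a′)) adj)

StartsAt-∷ʳ⁻ : ∀ xs → StartsAt x (xs ∷ʳ w) → xs ≢ [] → StartsAt x xs
StartsAt-∷ʳ⁻ [] _ xs≢[] = ⊥-elim (xs≢[] refl)
StartsAt-∷ʳ⁻ (y ∷ xs) (_ , refl) _ = xs , refl

StartsAt⇒∈ : StartsAt x xs → x ∈ xs
StartsAt⇒∈ (_ , refl) = here refl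

StartsAt-++⁻ : ∀ xs → StartsAt x (xs ++ ys) → xs ≢ [] → x ∈ xs
StartsAt-++⁻ [] _ xs≢[] = ⊥-elim (xs≢[] refl)
StartsAt-++⁻ (y ∷ xs) (_ , refl) _ = here refl

-- The regular decomposition P = P₀ ; P₁ of a nearly regular path, with
-- P₀ = A ∷ʳ c and P₁ = c ∷ B ∷ʳ compl c.
record Decomposition (x : Lit) (P : List Lit) : Set where
  field
    A : List Lit
    c : Lit
    B : List Lit
    P≡ : P ≡ A ++ c ∷ (B ∷ʳ compl c)
    starts : StartsAt x (A ++ c ∷ B)
    unique : Unique (A ++ c ∷ B)
    regular : Regular (A ++ c ∷ B)

  K : List Lit
  K = A ++ c ∷ B

  P≡K∷ʳc̄ : P ≡ K ∷ʳ compl c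
  P≡K∷ʳc̄ = trans P≡ (sym (++-assoc A (c ∷ B) [ compl c ]))

  c∈K : c ∈ K
  c∈K = ∈-++⁺ʳ A (here refl)

  c̄∉K : compl c ∉ K
  c̄∉K = regular c c∈K

  A⊆K : A ⊆ K
  A⊆K = ∈-++⁺ˡ

  A∷ʳc⊆K : A ∷ʳ c ⊆ K
  A∷ʳc⊆K p = subst (_ ∈_) (++-assoc A [ c ] B) (∈-++⁺ˡ p)

  P≡A∷ʳc++ : P ≡ (A ∷ʳ c) ++ (B ∷ʳ compl c)
  P≡A∷ʳc++ = trans P≡ (sym (++-assoc A [ c ] _))

  B⊆K : B ⊆ K
  B⊆K = ∈-++⁺ʳ A ∘ there

  c∉A : c ∉ A
  c∉A c∈A = Unique-++⇒Disjoint A unique (c∈A , here refl)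

  c∉B : c ∉ B
  c∉B = Unique[x∷xs]⇒x∉xs (Unique-++⁻ʳ A unique)

  K⊆P : K ⊆ P
  K⊆P p = subst (_ ∈_) (sym P≡K∷ʳc̄) (∈-++⁺ˡ p)

  c̄∈P : compl c ∈ P
  c̄∈P = subst (_ ∈_) (sym P≡K∷ʳc̄) (∈-∷ʳ K)

  ∈P⁻ : a ∈ P → a ∈ K ⊎ a ≡ compl c
  ∈P⁻ p = ∈-∷ʳ⁻ K (subst (_ ∈_) P≡K∷ʳc̄ p)

  unique-P : Unique P
  unique-P = subst Unique (sym P≡K∷ʳc̄) (Unique-∷ʳ⁺ unique c̄∉K)

  starts-P : StartsAt x P
  starts-P with starts
  ... | r , e = r ∷ʳ compl c , trans P≡K∷ʳc̄ (cong (_∷ʳ compl c) e)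

  x∈K : x ∈ K
  x∈K = StartsAt⇒∈ starts

  x≢c̄ : x ≢ compl c
  x≢c̄ e = c̄∉K (subst (_∈ K) e x∈K)

  only-pair : OnlyComplPair P c
  only-pair m p q with ∈P⁻ p | ∈P⁻ q
  ... | inj₁ p′ | inj₁ q′ = ⊥-elim (regular m p′ q′)
  ... | inj₁ _ | inj₂ e = inj₁ (compl-injective e)
  ... | inj₂ e | _ = inj₂ e

  nearly-regular : NearlyRegular P
  nearly-regular = (c , K⊆P c∈K , c̄∈P , only-pair) , K , compl c , P≡K∷ʳc̄ , regular

  compl∉P : a ∈ K → a ≢ c → compl a ∉ P
  compl∉P a∈K a≢c q with ∈P⁻ q
  ... | inj₁ q′ = regular _ a∈K q′
  ... | inj₂ e = a≢c (compl-injective e)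

  flip-regular : ∀ L Y Z → P ≡ L ++ Y ++ Z → (c ∈ Y × compl c ∈ L ++ Z) ⊎ (compl c ∈ Y × c ∈ L ++ Z) →
    Regular (L ++ map compl Y ++ Z)
  flip-regular L Y Z P≡′ = Regular-flip-separating L Y Z (subst Unique P≡′ unique-P)
    (subst (λ Q → OnlyComplPair Q c) P≡′ only-pair)

compl-last∈init : ∀ ws → Regular ws → l ∈ ws ∷ʳ w → compl l ∈ ws ∷ʳ w → compl w ∈ ws
compl-last∈init ws reg p q with ∈-∷ʳ⁻ ws p | ∈-∷ʳ⁻ ws q
... | inj₁ p′ | inj₁ q′ = ⊥-elim (reg _ p′ q′)
... | inj₁ p′ | inj₂ e = subst (_∈ ws) (compl-≡⇒≡compl e) p′
... | inj₂ refl | inj₁ q′ = q′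
... | inj₂ refl | inj₂ e = ⊥-elim (compl-≢ _ e)

decompose : Unique P → StartsAt x P → NearlyRegular P → Decomposition x P
decompose {P} {x} uP sP ((l , l∈ , l̄∈ , _) , ws , w , P≡ws∷ʳw , reg)
  with ∈-∃++ (compl-last∈init ws reg (subst (l ∈_) P≡ws∷ʳw l∈) (subst (compl l ∈_) P≡ws∷ʳw l̄∈))
... | A , B , refl = record
  { A = A ; c = compl w ; B = B
  ; P≡ = trans P≡ws∷ʳw (trans (cong (ws ∷ʳ_) (sym (compl-involutive w))) (++-assoc A (compl w ∷ B) _))
  ; starts = StartsAt-∷ʳ⁻ ws (subst (StartsAt x) P≡ws∷ʳw sP) (++-∷≢[] A)
  ; unique = Unique-++⁻ˡ ws (subst Unique P≡ws∷ʳw uP)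
  ; regular = reg
  }

∈-init⇒Adj : ∀ xs → a ∈ xs → ∃ λ b → Adj (xs ∷ʳ w) a b
∈-init⇒Adj {w = w} (_ ∷ []) (here refl) = w , [] , [] , refl
∈-init⇒Adj {w = w} (_ ∷ y ∷ xs) (here refl) = y , [] , xs ∷ʳ w , refl
∈-init⇒Adj (_ ∷ xs) (there p) with ∈-init⇒Adj xs p
... | b , adj = b , Adj-∷⁺ adj

IsVertex-compl : IsVertex F l → IsVertex F (compl l)
IsVertex-compl {l = l} (C , C∈ , hv) = C , C∈ , subst (λ v → HasVar v C) (sym (var-compl l)) hv

Arc⇒IsVertex : Arc F u v → IsVertex F u
Arc⇒IsVertex (bin₁ a b _ C∈) = _ , C∈ , a , here refl , sym (var-compl a)
Arc⇒IsVertex (bin₂ a b _ C∈) = _ , C∈ , b , there (here refl) , sym (var-compl b)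
Arc⇒IsVertex (unit a C∈) = _ , C∈ , a , here refl , sym (var-compl a)

Arc-contra : Arc F u v → Arc F (compl v) (compl u)
Arc-contra (bin₁ a b a≢b C∈) = subst (Arc _ _) (sym (compl-involutive a)) (bin₂ a b a≢b C∈)
Arc-contra (bin₂ a b a≢b C∈) = subst (Arc _ _) (sym (compl-involutive b)) (bin₁ a b a≢b C∈)
Arc-contra (unit a C∈) = subst (Arc _ _) (sym (compl-involutive a)) (unit a C∈)

Arc⇒cl∈ᶜ : Arc F u v → cl u v ∈ᶜ F
Arc⇒cl∈ᶜ (bin₁ a b _ C∈) = ∈ᶜ-resp-≐ (pair-≡⇒≐ (sym (compl-involutive a)) refl) C∈
Arc⇒cl∈ᶜ (bin₂ a b _ C∈) = ∈ᶜ-resp-≐ (≐-trans pair-swap (pair-≡⇒≐ (sym (compl-involutive b)) refl)) C∈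
Arc⇒cl∈ᶜ (unit a C∈) = ∈ᶜ-resp-≐ (≐-trans (≐-sym pair-dup) (pair-≡⇒≐ (sym (compl-involutive a)) refl)) C∈

module _ {x P} (d : Decomposition x P) where
  open Decomposition d

  Decomposition⇒InU : (∀ {a b} → Adj P a b → Arc F a b) → InU F x P
  Decomposition⇒InU arc =
    (P≢[] , All.tabulate vertex , unique-P , Adj⇒Linked P arc) , starts-P , nearly-regular
    where
    P≢[] : P ≢ []
    P≢[] = ++-∷≢[] K ∘ trans (sym P≡K∷ʳc̄)
    vertex-K : a ∈ K → IsVertex _ a
    vertex-K p with ∈-init⇒Adj K p
    ... | _ , adj = Arc⇒IsVertex (arc (subst (λ L → Adj L _ _) (sym P≡K∷ʳc̄) adj))
    vertex : a ∈ P → IsVertex _ a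
    vertex p with ∈P⁻ p
    ... | inj₁ p′ = vertex-K p′
    ... | inj₂ refl = IsVertex-compl {l = c} (vertex-K c∈K)

  FP-unsat : Unsat (FP x P)
  FP-unsat (φ , here vx ∷ sat-arcs) = valLit-consistent {l = c} (holds c∈P) (holds c̄∈P)
    where
    step : Adj P a b → valLit φ a ≡ true → valLit φ b ≡ true
    step adj = modus-ponens (All.lookup sat-arcs (∈-map⁺ _ (Adj⇒∈arcs P adj)))
    c∈P : c ∈ P
    c∈P = K⊆P c∈K
    holds : a ∈ P → valLit φ a ≡ true
    holds = true-along-path P starts-P vx step

-- Minimality of F(P)

record HittingSet (x : Lit) (P : List Lit) (C : Clause) : Set where
  field
    T : List Lit
    regular : Regular T
    hits-unit : C ≐ (x ∷ []) ⊎ x ∈ T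
    hits-arc : Adj P a b → C ≐ cl a b ⊎ Any (_∈ T) (cl a b)

HittingSet-resp-≐ : C ≐ D → HittingSet x P C → HittingSet x P D
HittingSet-resp-≐ e h = record
  { T = T ; regular = regular
  ; hits-unit = Sum.map₁ (≐-trans (≐-sym e)) hits-unit
  ; hits-arc = Sum.map₁ (≐-trans (≐-sym e)) ∘ hits-arc
  }
  where open HittingSet h

HittingSet⇒Satisfiable : HittingSet x P C → IsRemoval (FP x P) C G → Satisfiable G
HittingSet⇒Satisfiable {x} {C = C} h removal = Regular⇒Satisfiable regular (All.tabulate hit)
  where
  open HittingSet h
  hit : D ∈ _ → Any (_∈ T) D
  hit {D} D∈G with to (removal D) (∈⇒∈ᶜ D∈G)
  ... | D∈FP , D≉C with FP-∈⁻ D∈FP | hits-unit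
  ... | inj₁ e | inj₁ e′ = ⊥-elim (D≉C (≐-trans e (≐-sym e′)))
  ... | inj₁ e | inj₂ x∈T = lose (from (e x) (here refl)) x∈T
  ... | inj₂ (a , b , adj , e) | _ with hits-arc adj
  ... | inj₁ e′ = ⊥-elim (D≉C (≐-trans e (≐-sym e′)))
  ... | inj₂ h′ = Any-resp-≐ (≐-sym e) h′

flip-hits : ∀ L Y Z → Adj (L ++ Y ++ Z) a b →
  Junction L (Y ++ Z) a b ⊎ Any (_∈ L ++ map compl Y ++ Z) (cl a b)
flip-hits L Y Z adj with Adj-++⁻ L adj
... | inj₁ adj′ = inj₂ (there (here (∈-++⁺ˡ (proj₂ (Adj⇒∈ adj′)))))
... | inj₂ (inj₂ j) = inj₁ j
... | inj₂ (inj₁ adj′) with Adj-++⁻ Y adj′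
... | inj₁ adj″ = inj₂ (here (∈-++⁺ʳ L (∈-++⁺ˡ (∈-map⁺ compl (proj₁ (Adj⇒∈ adj″))))))
... | inj₂ (inj₁ adj″) = inj₂ (there (here (∈-++⁺ʳ L (∈-++⁺ʳ (map compl Y) (proj₂ (Adj⇒∈ adj″))))))
... | inj₂ (inj₂ ((Y′ , refl) , _)) = inj₂ (here (∈-++⁺ʳ L (∈-++⁺ˡ (∈-map⁺ compl (∈-∷ʳ Y′)))))

cut-hittingSet : ∀ L Y Z → P ≡ (L ∷ʳ u) ++ (v ∷ Y) ++ Z → StartsAt x P →
  Regular ((L ∷ʳ u) ++ map compl (v ∷ Y) ++ Z) → HittingSet x P (cl u v)
cut-hittingSet {P} {u} {v} {x} L Y Z P≡ sP reg = record
  { T = (L ∷ʳ u) ++ map compl (v ∷ Y) ++ Z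
  ; regular = reg
  ; hits-unit = inj₂ (∈-++⁺ˡ (StartsAt-++⁻ (L ∷ʳ u) (subst (StartsAt x) P≡ sP) (++-∷≢[] L)))
  ; hits-arc = hits-arc
  }
  where
  hits-arc : Adj P a b → cl u v ≐ cl a b ⊎ _
  hits-arc adj with flip-hits (L ∷ʳ u) (v ∷ Y) Z (subst (λ Q → Adj Q _ _) P≡ adj)
  ... | inj₂ h = inj₂ h
  ... | inj₁ ((L′ , e₁) , (Y′ , e₂)) with ∷ʳ-injective L L′ e₁ | ∷-injective e₂
  ... | _ , refl | refl , _ = inj₁ ≐-refl

module _ {x P} (d : Decomposition x P) where
  open Decomposition d

  unit-hittingSet : C ≐ (x ∷ []) → HittingSet x P C
  unit-hittingSet e = record
    { T = map compl (A ∷ʳ c) ++ (B ∷ʳ compl c)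
    ; regular = flip-regular [] (A ∷ʳ c) (B ∷ʳ compl c) P≡A∷ʳc++ (inj₁ (∈-∷ʳ A , ∈-∷ʳ B))
    ; hits-unit = inj₁ e
    ; hits-arc = λ adj →
        case flip-hits [] (A ∷ʳ c) (B ∷ʳ compl c) (subst (λ Q → Adj Q _ _) P≡A∷ʳc++ adj) of λ where
          (inj₁ ((L′ , e′) , _)) → ⊥-elim (++-∷≢[] L′ (sym e′))
          (inj₂ h) → inj₂ h
    }

  P₀-arc-hittingSet : Adj (A ∷ʳ c) u v → HittingSet x P (cl u v)
  P₀-arc-hittingSet {u} {v} (X , Y , e) = cut-hittingSet X Y (B ∷ʳ compl c) P≡′ starts-P
    (flip-regular (X ∷ʳ u) (v ∷ Y) (B ∷ʳ compl c) P≡′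
      (inj₁ (∈-last-suffix (X ∷ʳ u) (sym split) , ∈-++⁺ʳ (X ∷ʳ u) (∈-∷ʳ B))))
    where
    split : A ∷ʳ c ≡ (X ∷ʳ u) ++ v ∷ Y
    split = trans e (sym (++-assoc X [ u ] (v ∷ Y)))
    P≡′ : P ≡ (X ∷ʳ u) ++ (v ∷ Y) ++ (B ∷ʳ compl c)
    P≡′ = trans P≡A∷ʳc++ (trans (cong (_++ _) split) (++-assoc (X ∷ʳ u) (v ∷ Y) _))

  P₁-arc-hittingSet : Adj (c ∷ B ∷ʳ compl c) u v → HittingSet x P (cl u v)
  P₁-arc-hittingSet {u} {v} (X , Y , e) = cut-hittingSet (A ++ X) Y [] P≡′ starts-P
    (flip-regular ((A ++ X) ∷ʳ u) (v ∷ Y) [] P≡′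
      (inj₂ (∈-last-suffix (X ∷ʳ u) {zs = c ∷ B} (sym split) , ∈-++⁺ˡ c∈)))
    where
    split : c ∷ B ∷ʳ compl c ≡ (X ∷ʳ u) ++ v ∷ Y
    split = trans e (sym (++-assoc X [ u ] (v ∷ Y)))
    c∈ : c ∈ (A ++ X) ∷ʳ u
    c∈ = subst (c ∈_) (sym (++-assoc A X [ u ]))
      (∈-++⁺ʳ A (StartsAt-++⁻ (X ∷ʳ u) (_ , sym split) (++-∷≢[] X)))
    P≡′ : P ≡ ((A ++ X) ∷ʳ u) ++ (v ∷ Y) ++ []
    P≡′ = begin
      P                               ≡⟨ P≡ ⟩
      A ++ c ∷ B ∷ʳ compl c           ≡⟨ cong (A ++_) split ⟩
      A ++ (X ∷ʳ u) ++ v ∷ Y          ≡⟨ sym (++-assoc A (X ∷ʳ u) (v ∷ Y)) ⟩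
      (A ++ X ∷ʳ u) ++ v ∷ Y          ≡⟨ cong (_++ v ∷ Y) (sym (++-assoc A X [ u ])) ⟩
      ((A ++ X) ∷ʳ u) ++ v ∷ Y        ≡⟨ cong (((A ++ X) ∷ʳ u) ++_) (sym (++-identityʳ (v ∷ Y))) ⟩
      ((A ++ X) ∷ʳ u) ++ (v ∷ Y) ++ [] ∎
      where open ≡-Reasoning

  hittingSet : C ∈ᶜ FP x P → HittingSet x P C
  hittingSet p with FP-∈⁻ p
  ... | inj₁ e = unit-hittingSet e
  ... | inj₂ (u , v , adj , e) with Adj-++⁻ (A ∷ʳ c) (subst (λ Q → Adj Q u v) P≡A∷ʳc++ adj)
  ... | inj₁ adj₀ = HittingSet-resp-≐ (≐-sym e) (P₀-arc-hittingSet adj₀)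
  ... | inj₂ (inj₁ adj₁) = HittingSet-resp-≐ (≐-sym e) (P₁-arc-hittingSet (Adj-∷⁺ adj₁))
  ... | inj₂ (inj₂ ((A′ , e₁) , (Y , e₂))) with ∷ʳ-injective A A′ e₁
  ... | _ , refl = HittingSet-resp-≐ (≐-sym e) (P₁-arc-hittingSet ([] , Y , cong (c ∷_) e₂))

  FP-MU : MU (FP x P)
  FP-MU = FP-unsat d , λ C p G removal → HittingSet⇒Satisfiable (hittingSet p) removal

-- The twin path P₀ ; contra P₁

StartsAt-++-∷ : ∀ A {B B′} {c} → StartsAt x (A ++ c ∷ B) → StartsAt x (A ++ c ∷ B′)
StartsAt-++-∷ [] (_ , refl) = _ , refl
StartsAt-++-∷ (_ ∷ A) (_ , refl) = _ , refl

cl-contra : cl (compl b) (compl a) ≐ cl a b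
cl-contra {b} = ≐-trans (pair-≡⇒≐ (compl-involutive b) refl) pair-swap

module _ {x P} (d : Decomposition x P) where
  open Decomposition d

  twin : List Lit
  twin = A ++ c ∷ (contra B ∷ʳ compl c)

  private
    A∷ʳc++ : ∀ X → A ++ c ∷ X ≡ (A ∷ʳ c) ++ X
    A∷ʳc++ X = sym (++-assoc A [ c ] X)
    unique′ : Unique ((A ∷ʳ c) ++ B)
    unique′ = subst Unique (A∷ʳc++ B) unique
    disjoint : Disjoint (A ∷ʳ c) B
    disjoint = Unique-++⇒Disjoint (A ∷ʳ c) unique′

  twin-decomposition : Decomposition x twin
  twin-decomposition = record
    { A = A ; c = c ; B = contra B ; P≡ = refl
    ; starts = StartsAt-++-∷ A starts
    ; unique = subst Unique (sym (A∷ʳc++ (contra B)))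
        (Unique.++⁺ (Unique-++⁻ˡ (A ∷ʳ c) unique′) (Unique-contra⁺ (Unique-++⁻ʳ (A ∷ʳ c) unique′))
          λ (p , q) → regular _ (A∷ʳc⊆K p) (B⊆K (∈-contra⁻ q)))
    ; regular = Regular-⊆ ⊆flipped
        (Regular-flip (A ∷ʳ c) B [] (disjoint ∘ Product.map₁ ∈-++-[]⁻)
          (Regular-⊆ (A∷ʳc⊆K ∘ ∈-++-[]⁻) regular) (Regular-⊆ B⊆K regular))
    }
    where
    ∈-++-[]⁻ : ∀ {xs : List Lit} {a} → a ∈ xs ++ [] → a ∈ xs
    ∈-++-[]⁻ {xs} = subst (_ ∈_) (++-identityʳ xs)
    ⊆flipped : A ++ c ∷ contra B ⊆ (A ∷ʳ c) ++ map compl B ++ []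
    ⊆flipped p with ∈-++⁻ (A ∷ʳ c) (subst (_ ∈_) (A∷ʳc++ (contra B)) p)
    ... | inj₁ q = ∈-++⁺ˡ q
    ... | inj₂ q = ∈-++⁺ʳ (A ∷ʳ c) (∈-++⁺ˡ {xs = map compl B} (Any.reverse⁻ q))

  twin≡A++contraP₁ : twin ≡ A ++ contra (c ∷ B ∷ʳ compl c)
  twin≡A++contraP₁ = cong (A ++_) (sym (contra-∷-∷ʳ c B))

  twin-Adj⁻ : Adj twin a b → Adj P a b ⊎ Adj P (compl b) (compl a)
  twin-Adj⁻ {a} {b} adj with Adj-++⁻ A (subst (λ Q → Adj Q a b) twin≡A++contraP₁ adj)
  ... | inj₁ adj′ = inj₁ (subst (λ Q → Adj Q a b) (sym P≡) (Adj-++⁺ˡ _ adj′))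
  ... | inj₂ (inj₁ adj′) = inj₂ (subst (λ Q → Adj Q _ _) (sym P≡) (Adj-++⁺ʳ A (Adj-contra⁻ adj′)))
  ... | inj₂ (inj₂ (endA , (Y′ , e))) with ∷-injective (trans (sym (contra-∷-∷ʳ c B)) e)
  ... | refl , _ = inj₁ (subst (λ Q → Adj Q a b) (sym P≡) (Junction⇒Adj (endA , (_ , refl))))

  twin-FP-⊆ᶜ : FP x twin ⊆ᶜ FP x P
  twin-FP-⊆ᶜ = FP-⊆ᶜ x∈ᶜFP λ adj → case twin-Adj⁻ adj of λ where
    (inj₁ adj′) → FP-∈⁺ adj′
    (inj₂ adj′) → ∈ᶜ-resp-≐ cl-contra (FP-∈⁺ adj′)

  twin-InU : (∀ {a b} → Adj P a b → Arc F a b) → InU F x twin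
  twin-InU arc = Decomposition⇒InU twin-decomposition λ adj → case twin-Adj⁻ adj of λ where
    (inj₁ adj′) → arc adj′
    (inj₂ adj′) → subst₂ (Arc _) (compl-involutive _) (compl-involutive _) (Arc-contra (arc adj′))

  twin≢ : B ≢ [] → twin ≢ P
  twin≢ B≢[] twin≡P with ≢[]⇒∈ B≢[]
  ... | b , b∈B = regular b (B⊆K b∈B) (B⊆K (∈-contra⁻ (subst (b ∈_) (sym contra-B≡B) b∈B)))
    where
    contra-B≡B : contra B ≡ B
    contra-B≡B = proj₁ (∷ʳ-injective _ _ (proj₂ (∷-injective (++-cancelˡ A _ _ (trans twin≡P P≡)))))

  twin≡ : B ≡ [] → twin ≡ P
  twin≡ B≡[] = trans (cong (λ X → A ++ c ∷ (contra X ∷ʳ compl c)) B≡[])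
                     (sym (trans P≡ (cong (λ X → A ++ c ∷ (X ∷ʳ compl c)) B≡[])))

twin-involutive : ∀ {x P} (d : Decomposition x P) → twin (twin-decomposition d) ≡ P
twin-involutive d = trans (cong (λ X → A ++ c ∷ (X ∷ʳ compl c)) (contra-involutive B)) (sym P≡)
  where open Decomposition d

twin-FP : ∀ {x P} (d : Decomposition x P) → FP x (twin d) ≐ᶜ FP x P
twin-FP {x} d = twin-FP-⊆ᶜ d ,
  subst (λ Q → FP x Q ⊆ᶜ FP x (twin d)) (twin-involutive d) (twin-FP-⊆ᶜ (twin-decomposition d))

-- Preimages of F(P)

Comparable : List Lit → List Lit → Set
Comparable Q P = (∃ λ t → Q ≡ P ++ t) ⊎ (∃ λ t → P ≡ Q ++ t)

Comparable-++⁺ : ∀ X {Q P} → Comparable Q P → Comparable (X ++ Q) (X ++ P)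
Comparable-++⁺ X {Q} {P} (inj₁ (t , refl)) = inj₁ (t , sym (++-assoc X P t))
Comparable-++⁺ X {Q} {P} (inj₂ (t , refl)) = inj₂ (t , sym (++-assoc X Q t))

follow-deterministic : ∀ {S : Lit → Lit → Set} r rs qs →
  (∀ {a b v} → Adj (r ∷ rs) a b → S a v → v ≡ b) →
  (∀ {a b} → Adj (r ∷ qs) a b → S a b) →
  Comparable (r ∷ qs) (r ∷ rs)
follow-deterministic r [] qs det path = inj₁ (qs , refl)
follow-deterministic r (r′ ∷ rs) [] det path = inj₂ (r′ ∷ rs , refl)
follow-deterministic r (r′ ∷ rs) (q′ ∷ qs) det path
  with det ([] , rs , refl) (path ([] , qs , refl))
... | refl = Comparable-++⁺ [ r ] (follow-deterministic r′ rs qs (det ∘ Adj-∷⁺) (path ∘ Adj-∷⁺))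

NearlyRegular⇒¬⊆Regular : NearlyRegular Q → Regular L → ¬ Q ⊆ L
NearlyRegular⇒¬⊆Regular ((l , p , q , _) , _) reg Q⊆L = reg l (Q⊆L p) (Q⊆L q)

NearlyRegular-prefix⇒≡ : NearlyRegular Q → NearlyRegular P → ∀ t → Q ≡ P ++ t → Q ≡ P
NearlyRegular-prefix⇒≡ {Q} {P} _ _ [] Q≡ = trans Q≡ (++-identityʳ P)
NearlyRegular-prefix⇒≡ (_ , ws , w , Q≡ws∷ʳw , reg) nrP (y ∷ t) Q≡ =
  ⊥-elim (NearlyRegular⇒¬⊆Regular nrP reg (∈-prefix _ (trans (sym Q≡) Q≡ws∷ʳw)))

NearlyRegular-Comparable⇒≡ : NearlyRegular Q → NearlyRegular P → Comparable Q P → Q ≡ P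
NearlyRegular-Comparable⇒≡ nrQ nrP (inj₁ (t , Q≡)) = NearlyRegular-prefix⇒≡ nrQ nrP t Q≡
NearlyRegular-Comparable⇒≡ nrQ nrP (inj₂ (t , P≡)) = sym (NearlyRegular-prefix⇒≡ nrP nrQ t P≡)

module _ {x P} (d : Decomposition x P) where
  open Decomposition d

  FP-successor-unique : a ∈ K → a ≢ c → Adj P a b → cl a v ∈ᶜ FP x P → v ≡ b
  FP-successor-unique a∈K a≢c adj p with FP-arc⁻ p (λ ā≡x → regular _ a∈K (subst (_∈ K) (sym ā≡x) x∈K))
  ... | inj₁ adj′ = Unique⇒Adj-functional unique-P adj′ adj
  ... | inj₂ adj′ = ⊥-elim (compl∉P a∈K a≢c (proj₂ (Adj⇒∈ adj′)))

  P₀-deterministic : Adj (A ∷ʳ c) a b → cl a v ∈ᶜ FP x P → v ≡ b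
  P₀-deterministic {a} adj = FP-successor-unique (A⊆K a∈A) (λ { refl → c∉A a∈A })
    (subst (λ L → Adj L _ _) (sym P≡A∷ʳc++) (Adj-++⁺ˡ _ adj))
    where a∈A = Adj-∷ʳ⁻ adj

  P₁-deterministic : Adj (B ∷ʳ compl c) a b → cl a v ∈ᶜ FP x P → v ≡ b
  P₁-deterministic {a} adj = FP-successor-unique (B⊆K a∈B) (λ { refl → c∉B a∈B })
    (subst (λ L → Adj L _ _) (sym P≡A∷ʳc++) (Adj-++⁺ʳ (A ∷ʳ c) adj))
    where a∈B = Adj-∷ʳ⁻ adj

  leaves-P₀ : StartsAt x Q → NearlyRegular Q → (∀ {a b} → Adj Q a b → cl a b ∈ᶜ FP x P) →
    ∃₂ λ q t → Q ≡ (A ∷ʳ c) ++ q ∷ t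
  leaves-P₀ {Q} (qs , refl) nrQ arcs with StartsAt-++-∷ A {B′ = []} starts
  ... | rs , A∷ʳc≡ with follow-deterministic x rs qs
                          (P₀-deterministic ∘ subst (λ L → Adj L _ _) (sym A∷ʳc≡)) arcs
  ... | inj₁ (q ∷ t , Q≡) = q , t , trans Q≡ (cong (_++ _) (sym A∷ʳc≡))
  ... | inj₁ ([] , Q≡) = ⊥-elim (NearlyRegular⇒¬⊆Regular nrQ regular
        (A∷ʳc⊆K ∘ subst (_ ∈_) (trans Q≡ (trans (++-identityʳ _) (sym A∷ʳc≡)))))
  ... | inj₂ (t , R≡) = ⊥-elim (NearlyRegular⇒¬⊆Regular nrQ regular
        (A∷ʳc⊆K ∘ subst (_ ∈_) (trans (sym R≡) (sym A∷ʳc≡)) ∘ ∈-++⁺ˡ))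

  follows-P₁ : ∀ {Q z Z′ t} → NearlyRegular Q → (∀ {a b} → Adj Q a b → cl a b ∈ᶜ FP x P) →
    B ∷ʳ compl c ≡ z ∷ Z′ → Q ≡ (A ∷ʳ c) ++ z ∷ t → Q ≡ P
  follows-P₁ {Q} {z} {Z′} {t} nrQ arcs B∷ʳc̄≡ Q≡ = NearlyRegular-Comparable⇒≡ nrQ nearly-regular
    (subst₂ Comparable (sym Q≡) (sym P≡′) (Comparable-++⁺ (A ∷ʳ c) (follow-deterministic z Z′ t
      (P₁-deterministic ∘ subst (λ L → Adj L _ _) (sym B∷ʳc̄≡))
      (arcs ∘ subst (λ L → Adj L _ _) (sym Q≡) ∘ Adj-++⁺ʳ (A ∷ʳ c)))))
    where
    P≡′ : P ≡ (A ∷ʳ c) ++ z ∷ Z′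
    P≡′ = trans P≡A∷ʳc++ (cong ((A ∷ʳ c) ++_) B∷ʳc̄≡)

  successor-of-c : ∃₂ λ z Z′ → B ∷ʳ compl c ≡ z ∷ Z′ × Adj P c z
  successor-of-c with ∷ʳ-as-∷ B (compl c)
  ... | z , Z′ , e = z , Z′ , e , A , Z′ , trans P≡ (cong (λ L → A ++ c ∷ L) e)

  predecessor-of-c̄ : ∃₂ λ p ws → Adj P p (compl c) × contra B ∷ʳ compl c ≡ compl p ∷ contra ws
  predecessor-of-c̄ with ∷-as-∷ʳ c B
  ... | ws , p , e = p , ws , subst (λ L → Adj L p (compl c)) (sym P≡′) (Adj-last (A ++ ws)) ,
                     trans (sym (contra-∷ c B)) (trans (cong contra e) (contra-∷ʳ ws p))
    where
    P≡′ : P ≡ ((A ++ ws) ∷ʳ p) ∷ʳ compl c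
    P≡′ = trans P≡K∷ʳc̄ (cong (_∷ʳ compl c) (trans (cong (A ++_) e) (sym (++-assoc A ws [ p ]))))

module _ {x P} (d : Decomposition x P) where
  open Decomposition d

  FP-paths≡P⊎twin : StartsAt x Q → NearlyRegular Q → (∀ {a b} → Adj Q a b → cl a b ∈ᶜ FP x P) →
    Q ≡ P ⊎ Q ≡ twin d
  FP-paths≡P⊎twin sQ nrQ arcs with leaves-P₀ d sQ nrQ arcs
  ... | q , t , Q≡
    with FP-arc⁻ (arcs (subst (λ L → Adj L c q) (sym Q≡) (Junction⇒Adj ((A , refl) , (t , refl))))) (x≢c̄ ∘ sym)
  ... | inj₁ c→q with successor-of-c d
  ... | z , Z′ , e , c→z with Unique⇒Adj-functional unique-P c→q c→z
  ... | refl = inj₁ (follows-P₁ d nrQ arcs e Q≡)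
  FP-paths≡P⊎twin sQ nrQ arcs | q , t , Q≡ | inj₂ q̄→c̄ with predecessor-of-c̄ d
  ... | p , ws , p→c̄ , e with compl-≡⇒≡compl (Unique⇒Adj-injective unique-P q̄→c̄ p→c̄)
  ... | refl = inj₂ (follows-P₁ (twin-decomposition d) nrQ (proj₂ (twin-FP d) _ ∘ arcs) e Q≡)

-- Surjectivity

Cls : Clause → Set
Cls C = IsUnit C ⊎ IsBinary C

implications : (G : ClauseSet) → All Cls G → List (Lit × Lit)
implications [] [] = []
implications (C ∷ G) (inj₁ (a , _) ∷ cs) = (compl a , a) ∷ implications G cs
implications (C ∷ G) (inj₂ (a , b , _) ∷ cs) = (compl a , b) ∷ (compl b , a) ∷ implications G cs

Arc-⊆ᶜ : F ⊆ᶜ G → Arc F u v → Arc G u v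
Arc-⊆ᶜ F⊆G (bin₁ a b a≢b p) = bin₁ a b a≢b (F⊆G _ p)
Arc-⊆ᶜ F⊆G (bin₂ a b a≢b p) = bin₂ a b a≢b (F⊆G _ p)
Arc-⊆ᶜ F⊆G (unit a p) = unit a (F⊆G _ p)

implications⇒Arc : ∀ G cs → (u , v) ∈ implications G cs → Arc G u v
implications⇒Arc (C ∷ G) (inj₁ (a , e) ∷ cs) (here refl) = unit a (here (≐-sym e))
implications⇒Arc (C ∷ G) (inj₂ (a , b , a≢b , e) ∷ cs) (here refl) = bin₁ a b a≢b (here (≐-sym e))
implications⇒Arc (C ∷ G) (inj₂ (a , b , a≢b , e) ∷ cs) (there (here refl)) = bin₂ a b a≢b (here (≐-sym e))
implications⇒Arc (C ∷ G) (inj₁ _ ∷ cs) (there p) = Arc-⊆ᶜ (λ _ → there) (implications⇒Arc G cs p)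
implications⇒Arc (C ∷ G) (inj₂ _ ∷ cs) (there (there p)) = Arc-⊆ᶜ (λ _ → there) (implications⇒Arc G cs p)

implications-skew : ∀ G cs → (u , v) ∈ implications G cs → (compl v , compl u) ∈ implications G cs
implications-skew (C ∷ G) (inj₁ (a , _) ∷ cs) (here refl) = here (cong (compl a ,_) (compl-involutive a))
implications-skew (C ∷ G) (inj₂ (a , b , _) ∷ cs) (here refl) =
  there (here (cong (compl b ,_) (compl-involutive a)))
implications-skew (C ∷ G) (inj₂ (a , b , _) ∷ cs) (there (here refl)) =
  here (cong (compl a ,_) (compl-involutive b))
implications-skew (C ∷ G) (inj₁ _ ∷ cs) (there p) = there (implications-skew G cs p)
implications-skew (C ∷ G) (inj₂ _ ∷ cs) (there (there p)) = there (there (implications-skew G cs p))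

implications-cover : ∀ G cs → C ∈ G → l ∈ C → ∃ λ l′ → l′ ∈ C × (compl l , l′) ∈ implications G cs
implications-cover (C ∷ G) (inj₁ (a , e) ∷ cs) (here refl) l∈C with ∈-[-]⁻ (to (e _) l∈C)
... | refl = _ , l∈C , here refl
implications-cover (C ∷ G) (inj₂ (a , b , _ , e) ∷ cs) (here refl) l∈C with ∈-pair⁻ (to (e _) l∈C)
... | inj₁ refl = b , from (e b) (there (here refl)) , here refl
... | inj₂ refl = a , from (e a) (here refl) , there (here refl)
implications-cover (C ∷ G) (inj₁ _ ∷ cs) (there p) l∈C with implications-cover G cs p l∈C
... | l′ , l′∈C , q = l′ , l′∈C , there q
implications-cover (C ∷ G) (inj₂ _ ∷ cs) (there p) l∈C with implications-cover G cs p l∈C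
... | l′ , l′∈C , q = l′ , l′∈C , there (there q)

module Reachability (E : List (Lit × Lit)) where

  _⟶_ : Lit → Lit → Set
  u ⟶ v = (u , v) ∈ E

  record Reach (x : Lit) : Set where
    field
      T : List Lit
      x∈T : x ∈ T
      reachable : t ∈ T → Star _⟶_ x t
      closed : u ⟶ v → u ∈ T → v ∈ T

  private
    closed-if : ∀ {T} W → (∀ {u v} → u ⟶ v → v ∉ T → (u , v) ∈ W) →
      (∀ {u v} → (u , v) ∈ W → u ∉ T) → u ⟶ v → u ∈ T → v ∈ T
    closed-if {v = v} {T} W pending stuck uv u∈T with v ∈? T
    ... | yes v∈T = v∈T
    ... | no v∉T = ⊥-elim (stuck (pending uv v∉T) u∈T)

    -- W is the worklist of arcs not yet followed; its length bounds the recursion.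
    grow : ∀ {x} n W T → length W ≡ n → x ∈ T → (∀ {t} → t ∈ T → Star _⟶_ x t) →
      (∀ {u v} → u ⟶ v → v ∉ T → (u , v) ∈ W) → W ⊆ E → Reach x
    grow zero [] T _ x∈T reachable pending _ = record
      { T = T ; x∈T = x∈T ; reachable = reachable ; closed = closed-if [] pending λ () }
    grow {x} (suc n) W T len x∈T reachable pending W⊆E with Any.any? (λ uv → proj₁ uv ∈? T) W
    ... | no stuck = record
      { T = T ; x∈T = x∈T ; reachable = reachable
      ; closed = closed-if W pending λ p u∈T → stuck (lose p u∈T) }
    ... | yes active with find active
    ... | (u , v) , uv∈W , u∈T with ∈-∃++ uv∈W
    ... | W₁ , W₂ , refl = grow n (W₁ ++ W₂) (v ∷ T) len′ (there x∈T) reachable′ pending′ W′⊆E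
      where
      len′ : length (W₁ ++ W₂) ≡ n
      len′ = ℕ.suc-injective (begin
        suc (length (W₁ ++ W₂))      ≡⟨ cong suc (length-++ W₁) ⟩
        suc (length W₁ ℕ.+ length W₂) ≡⟨ sym (ℕ.+-suc (length W₁) (length W₂)) ⟩
        length W₁ ℕ.+ length ((u , v) ∷ W₂) ≡⟨ sym (length-++ W₁) ⟩
        length W                     ≡⟨ len ⟩
        suc n                        ∎)
        where open ≡-Reasoning
      reachable′ : t ∈ v ∷ T → Star _⟶_ x t
      reachable′ (here refl) = reachable u∈T ◅◅ (W⊆E uv∈W ◅ ε)
      reachable′ (there t∈T) = reachable t∈T
      pending′ : ∀ {u′ v′} → u′ ⟶ v′ → v′ ∉ v ∷ T → (u′ , v′) ∈ W₁ ++ W₂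
      pending′ uv′ v′∉ with ∈-++⁻ W₁ (pending uv′ (v′∉ ∘ there))
      ... | inj₁ p = ∈-++⁺ˡ p
      ... | inj₂ (here refl) = ⊥-elim (v′∉ (here refl))
      ... | inj₂ (there p) = ∈-++⁺ʳ W₁ p
      W′⊆E : W₁ ++ W₂ ⊆ E
      W′⊆E p with ∈-++⁻ W₁ p
      ... | inj₁ q = W⊆E (∈-++⁺ˡ q)
      ... | inj₂ q = W⊆E (∈-++⁺ʳ W₁ (there q))

  reach : ∀ x → Reach x
  reach x = grow (length E) E (x ∷ []) refl (here refl) (λ { (here refl) → ε }) (λ uv _ → uv) (λ p → p)

Star-contra : {R : Lit → Lit → Set} → (∀ {a b} → R a b → R (compl b) (compl a)) →
  Star R s t → Star R (compl t) (compl s)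
Star-contra {R = R} skew w =
  Star.gmap compl (λ r → r) (Star.reverse {U = λ a b → R (compl a) (compl b)} skew w)

Last-++⁻ʳ : ∀ X {Y : List Lit} → Y ≢ [] → Last (X ++ Y) t → Last Y t
Last-++⁻ʳ [] _ last = last
Last-++⁻ʳ (x ∷ X) Y≢[] ([] , e) = ⊥-elim (Y≢[] (++-conicalʳ X _ (proj₂ (∷-injective e))))
Last-++⁻ʳ (x ∷ X) Y≢[] (w ∷ ws , e) = Last-++⁻ʳ X Y≢[] (ws , proj₂ (∷-injective e))

Star⇒path : {R : Lit → Lit → Set} → Star R s t →
  ∃ λ L → Unique (s ∷ L) × Linked R (s ∷ L) × Last (s ∷ L) t
Star⇒path ε = [] , [] ∷ [] , [-] , [] , refl
Star⇒path {s = s} (r ◅ w) with Star⇒path w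
... | L , u , lk , ws , e with s ∈? (_ ∷ L)
... | no s∉ = _ ∷ L , Unique-∷⁺ s∉ u , r ∷ lk , s ∷ ws , cong (s ∷_) e
... | yes s∈ with ∈-∃++ s∈
... | X , Y , e′ = Y , Unique-++⁻ʳ X (subst Unique e′ u) ,
  Adj⇒Linked (s ∷ Y) (Linked⇒Adj lk ∘ subst (λ L → Adj L _ _) (sym e′) ∘ Adj-++⁺ʳ X) ,
  Last-++⁻ʳ X (λ ()) (subst (λ L → Last L _) e′ (ws , e))

Regular-∷ʳ⇒NearlyRegular : ∀ {ws w} → Regular ws → compl w ∈ ws → NearlyRegular (ws ∷ʳ w)
Regular-∷ʳ⇒NearlyRegular {ws} {w} reg w̄∈ws = (w , ∈-∷ʳ ws , ∈-++⁺ˡ w̄∈ws , only) , ws , w , refl , reg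
  where
  only : OnlyComplPair (ws ∷ʳ w) w
  only m p q with ∈-∷ʳ⁻ ws p | ∈-∷ʳ⁻ ws q
  ... | inj₁ p′ | inj₁ q′ = ⊥-elim (reg m p′ q′)
  ... | inj₂ e | _ = inj₁ e
  ... | inj₁ _ | inj₂ e = inj₂ (compl-≡⇒≡compl e)

nearly-regular-prefix : ∀ acc rest → Regular acc → (∃ λ y → y ∈ rest × compl y ∈ acc) →
  ∃₂ λ D R → rest ≡ D ++ R × NearlyRegular (acc ++ D)
nearly-regular-prefix acc (z ∷ rest) reg (y , y∈ , ȳ∈) with compl z ∈? acc
... | yes z̄∈ = z ∷ [] , rest , refl , Regular-∷ʳ⇒NearlyRegular reg z̄∈
... | no z̄∉ with nearly-regular-prefix (acc ∷ʳ z) rest (Regular-∷ʳ⁺ reg z̄∉) (y , y∈rest y∈ , ∈-++⁺ˡ ȳ∈)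
  where
  y∈rest : y ∈ z ∷ rest → y ∈ rest
  y∈rest (here refl) = ⊥-elim (z̄∉ ȳ∈)
  y∈rest (there p) = p
... | D , R , refl , nr = z ∷ D , R , refl , subst NearlyRegular (++-assoc acc [ z ] D) nr

module _ {G : ClauseSet} {x : Lit} (cs : All Cls G) where
  open Reachability (implications G cs)

  Regular-Reach⇒Satisfiable : ∀ {φ} → All (SatClause φ) (remove (x ∷ []) G) →
    (r : Reach x) → Regular (Reach.T r) → Satisfiable G
  Regular-Reach⇒Satisfiable {φ} satφ r reg = override T φ , All.tabulate sat
    where
    open Reach r
    sat : C ∈ G → SatClause (override T φ) C
    sat {C} C∈G with C ≐? (x ∷ [])
    ... | yes e = lose (from (e x) (here refl)) (override-∈ reg x∈T)
    ... | no C≉x with Any.any? (_∈? T) C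
    ... | yes hit = Any.map (override-∈ reg) hit
    ... | no miss with find (All-SatClause-∈ᶜ satφ (from (remove-isRemoval _ G C) (∈⇒∈ᶜ C∈G , C≉x)))
    ... | l , l∈C , φl = lose l∈C (trans (override-∉ (miss ∘ lose l∈C) l̄∉T) φl)
      where
      l̄∉T : compl l ∉ T
      l̄∉T l̄∈T with implications-cover G cs C∈G l∈C
      ... | l′ , l′∈C , arc = miss (lose l′∈C (closed arc l̄∈T))

  module _ (mu : MU G) (x∈G : (x ∷ []) ∈ᶜ G) where
    open Reach (reach x)

    complementary-pair : ∃ λ t → t ∈ T × compl t ∈ T
    complementary-pair with Any.any? (λ t → compl t ∈? T) T
    ... | yes p = find p
    ... | no none with proj₂ mu (x ∷ []) x∈G _ (remove-isRemoval (x ∷ []) G)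
    ... | φ , satφ = ⊥-elim (proj₁ mu (Regular-Reach⇒Satisfiable satφ (reach x) λ t p q → none (lose p q)))

    walk-to-compl : Star _⟶_ x (compl x)
    walk-to-compl with complementary-pair
    ... | t , t∈T , t̄∈T = reachable t∈T ◅◅
      subst (λ z → Star _⟶_ z (compl x)) (compl-involutive t)
        (Star-contra (implications-skew G cs) (reachable t̄∈T))

    nearly-regular-path : ∃ λ D → Unique (x ∷ D) × NearlyRegular (x ∷ D) ×
      (∀ {a b} → Adj (x ∷ D) a b → a ⟶ b)
    nearly-regular-path with Star⇒path walk-to-compl
    ... | L , u , lk , ws , e with subst (compl x ∈_) (sym e) (∈-∷ʳ ws)
    ... | here x̄≡x = ⊥-elim (compl-≢ x x̄≡x)
    ... | there x̄∈L with nearly-regular-prefix (x ∷ []) L (λ { l (here refl) (here e) → compl-≢ l e })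
                           (compl x , x̄∈L , here (compl-involutive x))
    ... | D , R , refl , nr = D , Unique-++⁻ˡ (x ∷ D) u , nr , Linked⇒Adj lk ∘ Adj-++⁺ˡ R

    -- Kept opaque: a with-abstraction over this term would otherwise unfold the closure computation.
    opaque
      MU⇒FP-preimage : G ⊆ᶜ F → ∃ λ P → InU F x P × FP x P ≐ᶜ G
      MU⇒FP-preimage G⊆F with nearly-regular-path
      ... | D , u , nr , arc = x ∷ D ,
        Decomposition⇒InU d (Arc-⊆ᶜ G⊆F ∘ implications⇒Arc G cs ∘ arc) ,
        FP⊆G , MU-⊆ᶜ mu FP⊆G (FP-unsat d)
        where
        d : Decomposition x (x ∷ D)
        d = decompose u (D , refl) nr
        FP⊆G : FP x (x ∷ D) ⊆ᶜ G
        FP⊆G = FP-⊆ᶜ x∈G (Arc⇒cl∈ᶜ ∘ implications⇒Arc G cs ∘ arc)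

UnitsAre-resp-≐ᶜ : F ≐ᶜ G → UnitsAre F a b → UnitsAre G a b
UnitsAre-resp-≐ᶜ (F⊆G , G⊆F) (a≢b , a∈ , b∈ , units) = a≢b , F⊆G _ a∈ , F⊆G _ b∈ , λ C → units C ∘ G⊆F C

TwoUnits-resp-≐ᶜ : F ≐ᶜ G → TwoUnits F → TwoUnits G
TwoUnits-resp-≐ᶜ e (a , b , u) = a , b , UnitsAre-resp-≐ᶜ e u

OneUnit-resp-≐ᶜ : F ≐ᶜ G → OneUnit F x → OneUnit G x
OneUnit-resp-≐ᶜ (F⊆G , G⊆F) (x∈ , units) = F⊆G _ x∈ , λ C → units C ∘ G⊆F C

module _ {x P} (d : Decomposition x P) where
  open Decomposition d

  B≡[]⇒P≡ : B ≡ [] → P ≡ A ++ c ∷ compl c ∷ []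
  B≡[]⇒P≡ B≡[] = trans P≡ (cong (λ L → A ++ c ∷ (L ∷ʳ compl c)) B≡[])

  B≡[]⇒Adj : B ≡ [] → Adj P c (compl c)
  B≡[]⇒Adj B≡[] = A , [] , B≡[]⇒P≡ B≡[]

  Adj-compl⇒B≡[] : Adj P a (compl a) → a ≡ c × B ≡ []
  Adj-compl⇒B≡[] {a} adj with only-pair a (proj₁ (Adj⇒∈ adj)) (proj₂ (Adj⇒∈ adj))
  ... | inj₂ refl = ⊥-elim (c̄∉K (Adj-∷ʳ⁻ (subst (λ L → Adj L _ _) P≡K∷ʳc̄ adj)))
  ... | inj₁ refl with successor-of-c d
  ... | z , Z′ , e , c→z with Unique⇒Adj-functional unique-P c→z adj | ∷ʳ-head B e
  ... | _ | inj₁ B≡[] = refl , B≡[]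
  ... | refl | inj₂ c̄∈B = ⊥-elim (c̄∉K (B⊆K c̄∈B))

  FP-unit⁻ : C ∈ᶜ FP x P → IsUnit C → C ≐ (x ∷ []) ⊎ (B ≡ [] × C ≐ (compl c ∷ []))
  FP-unit⁻ p (l , C≐l) with FP-∈⁻ p
  ... | inj₁ e = inj₁ e
  ... | inj₂ (a , b , adj , e) with pair≐[-]⁻ (≐-trans (≐-sym e) C≐l)
  ... | ā≡l , refl with Adj-compl⇒B≡[] (subst (Adj P a) (sym ā≡l) adj)
  ... | refl , B≡[] = inj₂ (B≡[] , subst (λ l → _ ≐ (l ∷ [])) (sym ā≡l) C≐l)

  B≡[]⇒unit∈ : B ≡ [] → (compl c ∷ []) ∈ᶜ FP x P
  B≡[]⇒unit∈ B≡[] = ∈ᶜ-resp-≐ pair-dup (FP-∈⁺ (B≡[]⇒Adj B≡[]))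

  B≡[]⇒UnitsAre : B ≡ [] → UnitsAre (FP x P) x (compl c)
  B≡[]⇒UnitsAre B≡[] = x≢c̄ , x∈ᶜFP , B≡[]⇒unit∈ B≡[] , λ C p u → Sum.map₂ proj₂ (FP-unit⁻ p u)

  TwoUnits⇒B≡[] : TwoUnits (FP x P) → B ≡ []
  TwoUnits⇒B≡[] (a , b , a≢b , a∈ , b∈ , _) with FP-unit⁻ a∈ (a , ≐-refl) | FP-unit⁻ b∈ (b , ≐-refl)
  ... | inj₂ (B≡[] , _) | _ = B≡[]
  ... | inj₁ _ | inj₂ (B≡[] , _) = B≡[]
  ... | inj₁ a≐x | inj₁ b≐x = ⊥-elim (a≢b (trans ([-]≐[-]⁻ a≐x) (sym ([-]≐[-]⁻ b≐x))))

  OneUnit⇒B≢[] : OneUnit (FP x P) x → B ≢ []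
  OneUnit⇒B≢[] (_ , units) B≡[] =
    x≢c̄ (sym ([-]≐[-]⁻ (units _ (B≡[]⇒unit∈ B≡[]) (compl c , ≐-refl))))

  FinalArcUnit⇔B≡[] : FinalArcUnit P ⇔ (B ≡ [])
  FinalArcUnit⇔B≡[] = mk⇔ (λ (ws , a , e) → proj₂ (Adj-compl⇒B≡[] (ws , [] , e)))
                          (λ B≡[] → A , c , B≡[]⇒P≡ B≡[])

VDeg-resp-≐ᶜ : ∀ {v n} → F ≐ᶜ G → VDeg F v n → VDeg G v n
VDeg-resp-≐ᶜ (F⊆G , G⊆F) (Cs , len , distinct , members , cover) =
  Cs , len , distinct , All.map (Product.map₁ (F⊆G _)) members , λ C → cover C ∘ G⊆F C

VDeg3⁺ : ∀ {v C₁ C₂ C₃} → ¬ C₁ ≐ C₂ → ¬ C₁ ≐ C₃ → ¬ C₂ ≐ C₃ →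
  C₁ ∈ᶜ F × HasVar v C₁ → C₂ ∈ᶜ F × HasVar v C₂ → C₃ ∈ᶜ F × HasVar v C₃ →
  (∀ D → D ∈ᶜ F → HasVar v D → D ≐ C₁ ⊎ D ≐ C₂ ⊎ D ≐ C₃) → VDeg F v 3
VDeg3⁺ ≉₁₂ ≉₁₃ ≉₂₃ h₁ h₂ h₃ cover =
  _ , refl , (≉₁₂ ∷ ≉₁₃ ∷ []) ∷ (≉₂₃ ∷ []) ∷ [] ∷ [] , h₁ ∷ h₂ ∷ h₃ ∷ [] ,
  λ D p hv → case cover D p hv of λ where
    (inj₁ e) → here e
    (inj₂ (inj₁ e)) → there (here e)
    (inj₂ (inj₂ e)) → there (there (here e))

¬VDeg3-two-classes : ∀ {v} (K₁ K₂ : Clause → Set) →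
  (∀ {D D′} → K₁ D → K₁ D′ → D ≐ D′) → (∀ {D D′} → K₂ D → K₂ D′ → D ≐ D′) →
  (∀ D → D ∈ᶜ F → HasVar v D → K₁ D ⊎ K₂ D) → ¬ VDeg F v 3
¬VDeg3-two-classes K₁ K₂ same₁ same₂ classify
  (C₁ ∷ C₂ ∷ C₃ ∷ [] , refl , (≉₁₂ ∷ ≉₁₃ ∷ []) ∷ (≉₂₃ ∷ []) ∷ _ , (p₁ , v₁) ∷ (p₂ , v₂) ∷ (p₃ , v₃) ∷ [] , _)
  with classify C₁ p₁ v₁ | classify C₂ p₂ v₂ | classify C₃ p₃ v₃
... | inj₁ k₁ | inj₁ k₂ | _ = ≉₁₂ (same₁ k₁ k₂)
... | inj₂ k₁ | inj₂ k₂ | _ = ≉₁₂ (same₂ k₁ k₂)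
... | inj₁ k₁ | inj₂ _ | inj₁ k₃ = ≉₁₃ (same₁ k₁ k₃)
... | inj₂ k₁ | inj₁ _ | inj₂ k₃ = ≉₁₃ (same₂ k₁ k₃)
... | inj₁ _ | inj₂ k₂ | inj₂ k₃ = ≉₂₃ (same₂ k₂ k₃)
... | inj₂ _ | inj₁ k₂ | inj₁ k₃ = ≉₂₃ (same₁ k₂ k₃)

HasVar-resp-≐ : ∀ {v} → C ≐ D → HasVar v C → HasVar v D
HasVar-resp-≐ e (l , l∈ , vl) = l , to (e l) l∈ , vl

HasVar-[-]⁻ : ∀ {v} → HasVar v (x ∷ []) → var x ≡ v
HasVar-[-]⁻ (l , here refl , vl) = vl

HasVar-cl⁻ : ∀ {v} → HasVar v (cl a b) → var a ≡ v ⊎ var b ≡ v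
HasVar-cl⁻ {a = a} (l , here refl , vl) = inj₁ (trans (sym (var-compl a)) vl)
HasVar-cl⁻ (l , there (here refl) , vl) = inj₂ vl

module _ {x P} (d : Decomposition x P) where
  open Decomposition d

  same-var⇒≡ : ∀ {l l′} → l ∈ P → l′ ∈ P → var l ≡ var l′ → var l ≢ var c → l ≡ l′
  same-var⇒≡ {l} {l′} l∈ l′∈ vl≡ vl≢ with var-≡⇒≡⊎≡compl l l′ vl≡
  ... | inj₁ e = e
  ... | inj₂ refl with only-pair l′ l′∈ l∈
  ... | inj₁ refl = ⊥-elim (vl≢ (var-compl c))
  ... | inj₂ refl = ⊥-elim (vl≢ (cong var (compl-involutive c)))

  ¬VDeg3 : ∀ {v} → v ≢ var c → v ≢ var x → ¬ VDeg (FP x P) v 3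
  ¬VDeg3 {v} v≢c v≢x = ¬VDeg3-two-classes Out In same-out same-in classify
    where
    Out In : Clause → Set
    Out D = ∃₂ λ l b → var l ≡ v × Adj P l b × D ≐ cl l b
    In D = ∃₂ λ l a → var l ≡ v × Adj P a l × D ≐ cl a l
    same-out : ∀ {D D′} → Out D → Out D′ → D ≐ D′
    same-out (l , b , refl , adj , e) (l′ , b′ , vl′ , adj′ , e′)
      with same-var⇒≡ (proj₁ (Adj⇒∈ adj)) (proj₁ (Adj⇒∈ adj′)) (sym vl′) v≢c
    ... | refl with Unique⇒Adj-functional unique-P adj adj′
    ... | refl = ≐-trans e (≐-sym e′)
    same-in : ∀ {D D′} → In D → In D′ → D ≐ D′
    same-in (l , a , refl , adj , e) (l′ , a′ , vl′ , adj′ , e′)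
      with same-var⇒≡ (proj₂ (Adj⇒∈ adj)) (proj₂ (Adj⇒∈ adj′)) (sym vl′) v≢c
    ... | refl with Unique⇒Adj-injective unique-P adj adj′
    ... | refl = ≐-trans e (≐-sym e′)
    classify : ∀ D → D ∈ᶜ FP x P → HasVar v D → Out D ⊎ In D
    classify D p hv with FP-∈⁻ p
    ... | inj₁ e = ⊥-elim (v≢x (sym (HasVar-[-]⁻ (HasVar-resp-≐ e hv))))
    ... | inj₂ (a , b , adj , e) with HasVar-cl⁻ (HasVar-resp-≐ e hv)
    ... | inj₁ va = inj₁ (a , b , va , adj , e)
    ... | inj₂ vb = inj₂ (b , a , vb , adj , e)

  FP-var-c⁻ : D ∈ᶜ FP x P → HasVar (var c) D →
    (D ≐ (x ∷ []) × var x ≡ var c) ⊎ (∃ λ a → Adj P a c × D ≐ cl a c) ⊎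
    (∃ λ b → Adj P c b × D ≐ cl c b) ⊎ (∃ λ a → Adj P a (compl c) × D ≐ cl a (compl c))
  FP-var-c⁻ p hv with FP-∈⁻ p
  ... | inj₁ e = inj₁ (e , HasVar-[-]⁻ (HasVar-resp-≐ e hv))
  ... | inj₂ (a , b , adj , e) with HasVar-cl⁻ (HasVar-resp-≐ e hv)
  ... | inj₁ va with var-≡⇒≡⊎≡compl a c va
  ... | inj₁ refl = inj₂ (inj₂ (inj₁ (b , adj , e)))
  ... | inj₂ refl = ⊥-elim (c̄∉K (Adj-∷ʳ⁻ (subst (λ L → Adj L _ _) P≡K∷ʳc̄ adj)))
  FP-var-c⁻ p hv | inj₂ (a , b , adj , e) | inj₂ vb with var-≡⇒≡⊎≡compl b c vb
  ... | inj₁ refl = inj₂ (inj₁ (a , adj , e))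
  ... | inj₂ refl = inj₂ (inj₂ (inj₂ (a , adj , e)))

  -- The clause through which P enters c: {x} if P starts at c, else that of the arc into c.
  in-clause : ∃ λ Cin → Cin ∈ᶜ FP x P × HasVar (var c) Cin × compl c ∉ Cin ×
    (∀ {D} → (D ≐ (x ∷ []) × var x ≡ var c) ⊎ (∃ λ a → Adj P a c × D ≐ cl a c) → D ≐ Cin)
  in-clause with []⊎∷ʳ A
  ... | inj₁ refl with starts
  ... | _ , e with ∷-injective e
  ... | refl , _ = x ∷ [] , x∈ᶜFP , (x , here refl , refl) , (λ { (here e) → x≢c̄ (sym e) }) , cover
    where
    cover : ∀ {D} → (D ≐ (x ∷ []) × var x ≡ var x) ⊎ (∃ λ a → Adj P a x × D ≐ cl a x) → D ≐ (x ∷ [])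
    cover (inj₁ (e , _)) = e
    cover (inj₂ (a , adj , _)) =
      ⊥-elim (Adj-head⁻ (subst Unique P≡ unique-P) (subst (λ L → Adj L a x) P≡ adj))
  in-clause | inj₂ (A′ , a₀ , A≡) =
    cl a₀ c , FP-∈⁺ a₀→c , (c , there (here refl) , refl) , c̄∉ , cover
    where
    a₀→c : Adj P a₀ c
    a₀→c = A′ , _ , trans P≡ (trans (cong (_++ _) A≡) (++-assoc A′ [ a₀ ] _))
    a₀∈A : a₀ ∈ A
    a₀∈A = subst (a₀ ∈_) (sym A≡) (∈-∷ʳ A′)
    c̄∉ : compl c ∉ cl a₀ c
    c̄∉ (here e) = c∉A (subst (_∈ A) (sym (compl-injective e)) a₀∈A)
    c̄∉ (there (here e)) = compl-≢ c e
    cover : ∀ {D} → (D ≐ (x ∷ []) × var x ≡ var c) ⊎ (∃ λ a → Adj P a c × D ≐ cl a c) → D ≐ cl a₀ c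
    cover (inj₁ (_ , vx≡vc)) with var-≡⇒≡⊎≡compl x c vx≡vc
    ... | inj₁ refl = ⊥-elim (c∉A (StartsAt-++⁻ A starts (++-∷≢[] A′ ∘ trans (sym A≡))))
    ... | inj₂ x≡c̄ = ⊥-elim (x≢c̄ x≡c̄)
    cover (inj₂ (a , adj , e)) with Unique⇒Adj-injective unique-P adj a₀→c
    ... | refl = e

  VDeg3-var-c : B ≢ [] → VDeg (FP x P) (var c) 3
  VDeg3-var-c B≢[] with successor-of-c d | predecessor-of-c̄ d | in-clause
  ... | z , _ , e , c→z | p , _ , p→c̄ , _ | Cin , Cin∈ , hv , c̄∉Cin , cover-in =
    VDeg3⁺ (λ e → c̄∉Cin (from (e _) (here refl))) (λ e → c̄∉Cin (from (e _) (there (here refl)))) ≉₂₃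
      (Cin∈ , hv) (FP-∈⁺ c→z , compl c , here refl , var-compl c)
      (FP-∈⁺ p→c̄ , compl c , there (here refl) , var-compl c) cover
    where
    z∈K : z ∈ K
    z∈K = case ∷ʳ-head B e of λ where
      (inj₁ B≡[]) → ⊥-elim (B≢[] B≡[])
      (inj₂ z∈B) → B⊆K z∈B
    p∈K : p ∈ K
    p∈K = Adj-∷ʳ⁻ (subst (λ L → Adj L p (compl c)) P≡K∷ʳc̄ p→c̄)
    ≉₂₃ : ¬ cl c z ≐ cl p (compl c)
    ≉₂₃ e with pair≐pair⁻ e
    ... | inj₁ (_ , refl) = c̄∉K z∈K
    ... | inj₂ (_ , refl) = regular p p∈K z∈K
    cover : ∀ D → D ∈ᶜ FP x P → HasVar (var c) D → D ≐ Cin ⊎ D ≐ cl c z ⊎ D ≐ cl p (compl c)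
    cover D q hv with FP-var-c⁻ q hv
    ... | inj₁ h = inj₁ (cover-in (inj₁ h))
    ... | inj₂ (inj₁ h) = inj₁ (cover-in (inj₂ h))
    ... | inj₂ (inj₂ (inj₁ (b , adj , e′))) with Unique⇒Adj-functional unique-P adj c→z
    ... | refl = inj₂ (inj₁ e′)
    cover D q hv | inj₂ (inj₂ (inj₂ (a , adj , e′))) with Unique⇒Adj-injective unique-P adj p→c̄
    ... | refl = inj₂ (inj₂ e′)

All-⊆ᶜ : {Q : Clause → Set} → (∀ {C D} → C ≐ D → Q D → Q C) → G ⊆ᶜ F → All Q F → All Q G
All-⊆ᶜ resp G⊆F all = All.tabulate λ C∈G → case find (G⊆F _ (∈⇒∈ᶜ C∈G)) of λ where
  (D , D∈F , e) → resp e (All.lookup all D∈F)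

Cls-resp-≐ : C ≐ D → Cls D → Cls C
Cls-resp-≐ e (inj₁ (a , e′)) = inj₁ (a , ≐-trans e e′)
Cls-resp-≐ e (inj₂ (a , b , a≢b , e′)) = inj₂ (a , b , a≢b , ≐-trans e e′)

NoCompPair-resp-≐ : C ≐ D → NoCompPair D → NoCompPair C
NoCompPair-resp-≐ e ncp l p q = ncp l (to (e _) p) (to (e _) q)

Cls⇒LenLe2 : Cls C → LenLe2 C
Cls⇒LenLe2 (inj₁ (a , e)) = a ∷ [] , s≤s z≤n , e
Cls⇒LenLe2 (inj₂ (a , b , _ , e)) = a ∷ b ∷ [] , s≤s (s≤s z≤n) , e

InMus⇒Family2CNF-MU : Is12ClauseSet F → InMus F x F′ → Family2CNF-MU F′
InMus⇒Family2CNF-MU (cs , cls) (F′⊆F , mu , _) =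
  All-⊆ᶜ NoCompPair-resp-≐ F′⊆F cs , mu , All.map Cls⇒LenLe2 (All-⊆ᶜ Cls-resp-≐ F′⊆F cls)

InU⇒Decomposition : InU F x P → Decomposition x P
InU⇒Decomposition ((_ , _ , u , _) , s , nr) = decompose u s nr

InU⇒Arc : InU F x P → Adj P a b → Arc F a b
InU⇒Arc ((_ , _ , _ , lk) , _) = Linked⇒Adj lk

FP∈mus : (x ∷ []) ∈ᶜ F → InU F x P → InMus F x (FP x P)
FP∈mus x∈F inU = FP-⊆ᶜ x∈F (Arc⇒cl∈ᶜ ∘ InU⇒Arc inU) , FP-MU (InU⇒Decomposition inU) , x∈ᶜFP

mus⇒FP-preimage : Is12ClauseSet F → InMus F x F′ → ∃ λ P → InU F x P × FP x P ≐ᶜ F′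
mus⇒FP-preimage (_ , cls) (F′⊆F , mu , x∈F′) = MU⇒FP-preimage (All-⊆ᶜ Cls-resp-≐ F′⊆F cls) mu x∈F′ F′⊆F

PreimageIsPair-twin : (inU : InU F x P) → FP x P ≐ᶜ F′ →
  PreimageIsPair F x F′ P (twin (InU⇒Decomposition inU))
PreimageIsPair-twin {x = x} {P = P} inU e R = mk⇔ into out
  where
  d : Decomposition x P
  d = InU⇒Decomposition inU
  into : InPreimage _ _ _ R → R ≡ _ ⊎ R ≡ twin d
  into ((_ , sR , nrR) , eR) = FP-paths≡P⊎twin d sR nrR λ adj → proj₂ e _ (proj₁ eR _ (FP-∈⁺ adj))
  out : R ≡ _ ⊎ R ≡ twin d → InPreimage _ _ _ R
  out (inj₁ refl) = inU , e
  out (inj₂ refl) = twin-InU d (InU⇒Arc inU) , ≐ᶜ-trans (twin-FP d) e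

twin≡⇒TwoUnits : ∀ {x P} (d : Decomposition x P) → twin d ≡ P → TwoUnits (FP x P)
twin≡⇒TwoUnits d twin≡P with ≡[]⊎≢[] (Decomposition.B d)
... | inj₁ B≡[] = _ , _ , B≡[]⇒UnitsAre d B≡[]
... | inj₂ B≢[] = ⊥-elim (twin≢ d B≢[] twin≡P)

preimage-one⇔two-units : Is12ClauseSet F → InMus F x F′ → PreimageIsOne F x F′ ⇔ TwoUnits F′
preimage-one⇔two-units {F} {x} {F′} h12 mus = mk⇔ one⇒two two⇒one
  where
  one⇒two : PreimageIsOne F x F′ → TwoUnits F′
  one⇒two (P , (inU , e) , only) =
    TwoUnits-resp-≐ᶜ e
      (twin≡⇒TwoUnits d (only (twin d) (from (PreimageIsPair-twin inU e (twin d)) (inj₂ refl))))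
    where
    d : Decomposition x P
    d = InU⇒Decomposition inU
  two⇒one : TwoUnits F′ → PreimageIsOne F x F′
  two⇒one two with mus⇒FP-preimage h12 mus
  ... | P , inU , e = P , (inU , e) , λ Q pre → case to (PreimageIsPair-twin inU e Q) pre of λ where
      (inj₁ Q≡P) → Q≡P
      (inj₂ Q≡twin) → trans Q≡twin (twin≡ d (TwoUnits⇒B≡[] d (TwoUnits-resp-≐ᶜ (≐ᶜ-sym e) two)))
    where
    d : Decomposition x P
    d = InU⇒Decomposition inU

two-units⇔final-arc-unit : InU F x P → TwoUnits (FP x P) ⇔ FinalArcUnit P
two-units⇔final-arc-unit {x = x} {P = P} inU = mk⇔
  (from (FinalArcUnit⇔B≡[] d) ∘ TwoUnits⇒B≡[] d)
  (λ final → _ , _ , B≡[]⇒UnitsAre d (to (FinalArcUnit⇔B≡[] d) final))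
  where
  d : Decomposition x P
  d = InU⇒Decomposition inU

IsPath-++⁻ˡ : ∀ X {Y} → X ≢ [] → IsPath F (X ++ Y) → IsPath F X
IsPath-++⁻ˡ X X≢[] (_ , vertices , u , lk) =
  X≢[] , All.++⁻ˡ X vertices , Unique-++⁻ˡ X u , Adj⇒Linked X (Linked⇒Adj lk ∘ Adj-++⁺ˡ _)

module _ {x P} (d : Decomposition x P) where
  open Decomposition d

  final-arc-unit-structure : IsPath F P → P ≡ ws ++ (a ∷ compl a ∷ []) →
      UnitsAre (FP x P) x (compl a)
    × IsPath F (ws ∷ʳ a) × StartsAt x (ws ∷ʳ a)
    × Last (ws ∷ʳ a) (compl (compl a)) × Regular (ws ∷ʳ a)
  final-arc-unit-structure {ws = ws} {a} path P≡ws++ with Adj-compl⇒B≡[] d (ws , [] , P≡ws++)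
  ... | refl , B≡[] =
    B≡[]⇒UnitsAre d B≡[] ,
    subst (IsPath _) ws∷ʳa≡ (IsPath-++⁻ˡ (A ∷ʳ c) (++-∷≢[] A) (subst (IsPath _) P≡′ path)) ,
    subst (StartsAt _) ws∷ʳa≡ (StartsAt-++-∷ A starts) ,
    (ws , cong (ws ∷ʳ_) (sym (compl-involutive a))) ,
    subst Regular ws∷ʳa≡ (Regular-⊆ A∷ʳc⊆K regular)
    where
    P≡′ : P ≡ (A ∷ʳ c) ++ compl c ∷ []
    P≡′ = trans (B≡[]⇒P≡ d B≡[]) (sym (++-assoc A [ c ] _))
    ws∷ʳa≡ : A ∷ʳ c ≡ ws ∷ʳ a
    ws∷ʳa≡ = ++-cancelʳ [ compl c ] (A ∷ʳ c) (ws ∷ʳ a)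
      (trans (sym P≡′) (trans P≡ws++ (sym (++-assoc ws [ a ] _))))

one-unit⇒preimage-two : Is12ClauseSet F → InMus F x F′ → OneUnit F′ x → PreimageHasTwo F x F′
one-unit⇒preimage-two {x = x} h12 mus one with mus⇒FP-preimage h12 mus
... | P , inU , e = P , twin d , twin≢ d B≢[] ∘ sym , PreimageIsPair-twin inU e
  where
  d : Decomposition x P
  d = InU⇒Decomposition inU
  B≢[] : Decomposition.B d ≢ []
  B≢[] = OneUnit⇒B≢[] d (OneUnit-resp-≐ᶜ (≐ᶜ-sym e) one)

module _ {x P} (d : Decomposition x P) where
  open Decomposition d

  Last-compl⇒c≡ : Last P (compl x) → c ≡ x
  Last-compl⇒c≡ (ws , P≡ws∷ʳx̄) =
    compl-injective (sym (proj₂ (∷ʳ-injective ws K (trans (sym P≡ws∷ʳx̄) P≡K∷ʳc̄))))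

  c≡x⇒A≡[] : c ≡ x → A ≡ []
  c≡x⇒A≡[] c≡x with ≡[]⊎≢[] A
  ... | inj₁ A≡[] = A≡[]
  ... | inj₂ A≢[] = ⊥-elim (c∉A (subst (_∈ A) (sym c≡x) (StartsAt-++⁻ A starts A≢[])))

  c≡x⇒contra≡twin : c ≡ x → contra P ≡ twin d
  c≡x⇒contra≡twin c≡x = begin
    contra P                          ≡⟨ cong contra (trans P≡ (cong (_++ _) A≡[])) ⟩
    contra (c ∷ B ∷ʳ compl c)         ≡⟨ contra-∷-∷ʳ c B ⟩
    c ∷ contra B ∷ʳ compl c           ≡⟨ cong (_++ _) (sym A≡[]) ⟩
    twin d                            ∎
    where
    open ≡-Reasoning
    A≡[] : A ≡ []
    A≡[] = c≡x⇒A≡[] c≡x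

  RegDecomp⇒≡twin : ∀ {P₀ P₁} → RegDecomp P P₀ P₁ → P₀ ⨾ contra P₁ ≡ twin d
  RegDecomp⇒≡twin (w , (ws , P≡ws∷ʳw) , ps , qs , P≡ps++ , refl , refl)
    with proj₂ (∷ʳ-injective ws K (trans (sym P≡ws∷ʳw) P≡K∷ʳc̄))
  ... | refl rewrite compl-involutive c
    with Unique-split-injective ps qs A (B ∷ʳ compl c) (subst Unique P≡ps++ unique-P) (trans (sym P≡ps++) P≡)
  ... | refl , refl = begin
    (A ∷ʳ c) ⨾ contra (c ∷ B ∷ʳ compl c) ≡⟨ cong (λ L → (A ∷ʳ c) ++ drop 1 L) (contra-∷-∷ʳ c B) ⟩
    (A ∷ʳ c) ++ (contra B ∷ʳ compl c)    ≡⟨ ++-assoc A [ c ] _ ⟩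
    twin d                               ∎
    where open ≡-Reasoning

module _ {F x F′} (h12 : Is12ClauseSet F) (mus : InMus F x F′) (one : OneUnit F′ x)
         {P} (inU : InU F x P) (e : FP x P ≐ᶜ F′) where
  private
    d : Decomposition x P
    d = InU⇒Decomposition inU
    B≢[] : Decomposition.B d ≢ []
    B≢[] = OneUnit⇒B≢[] d (OneUnit-resp-≐ᶜ (≐ᶜ-sym e) one)
    famII : FamilyII F′ x
    famII = InMus⇒Family2CNF-MU h12 mus , one
    VDeg3-var-c′ : VDeg F′ (var (Decomposition.c d)) 3
    VDeg3-var-c′ = VDeg-resp-≐ᶜ e (VDeg3-var-c d B≢[])
  open Decomposition d

  ending-at-compl-x : Last P (compl x) →
      pathLength P ≥ 2 × FamilyIIa F′ x × contra P ≢ P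
    × InU F x (contra P) × FP x (contra P) ≐ᶜ FP x P
    × PreimageIsPair F x F′ P (contra P)
  ending-at-compl-x last =
    subst (λ Q → pathLength Q ≥ 2) (sym P≡c∷) (length-∷ʳ≥2 B≢[]) ,
    (famII , subst (λ z → VDeg F′ (var z) 3) c≡x VDeg3-var-c′ , only-var-x) ,
    subst (_≢ P) contra≡ (twin≢ d B≢[]) ,
    subst (InU F x) contra≡ (twin-InU d (InU⇒Arc inU)) ,
    subst (λ Q → FP x Q ≐ᶜ FP x P) contra≡ (twin-FP d) ,
    subst (PreimageIsPair F x F′ P) contra≡ (PreimageIsPair-twin inU e)
    where
    c≡x : c ≡ x
    c≡x = Last-compl⇒c≡ d last
    contra≡ : twin d ≡ contra P
    contra≡ = sym (c≡x⇒contra≡twin d c≡x)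
    P≡c∷ : P ≡ c ∷ B ∷ʳ compl c
    P≡c∷ = trans P≡ (cong (_++ c ∷ B ∷ʳ compl c) (c≡x⇒A≡[] d c≡x))
    only-var-x : ∀ v → VDeg F′ v 3 → v ≡ var x
    only-var-x v vd with v ℕ.≟ var x
    ... | yes v≡x = v≡x
    ... | no v≢x = ⊥-elim (¬VDeg3 d (v≢x ∘ flip trans (cong var c≡x)) v≢x (VDeg-resp-≐ᶜ (≐ᶜ-sym e) vd))

  not-ending-at-compl-x : ¬ Last P (compl x) →
      FamilyIIb F′ x
    × (∀ P₀ P₁ → RegDecomp P P₀ P₁ → (P₀ ⨾ contra P₁) ≢ P × PreimageIsPair F x F′ P (P₀ ⨾ contra P₁))
  not-ending-at-compl-x ¬last =
    (famII , λ (_ , _ , only-var-x) → var-c≢var-x (only-var-x _ VDeg3-var-c′)) ,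
    λ P₀ P₁ dec → subst (_≢ P) (sym (RegDecomp⇒≡twin d dec)) (twin≢ d B≢[]) ,
                  subst (PreimageIsPair F x F′ P) (sym (RegDecomp⇒≡twin d dec)) (PreimageIsPair-twin inU e)
    where
    var-c≢var-x : var c ≢ var x
    var-c≢var-x vc≡vx with var-≡⇒≡⊎≡compl c x vc≡vx
    ... | inj₁ c≡x = ¬last (K , subst (λ z → P ≡ K ∷ʳ compl z) c≡x P≡K∷ʳc̄)
    ... | inj₂ c≡x̄ = x≢c̄ (compl-≡⇒≡compl (sym c≡x̄))

theorem6p4 : (F : ClauseSet) (x : Lit) → Is12ClauseSet F → (x ∷ []) ∈ᶜ F →
    -- 1. surjection onto mus_{x}(F)
    ((∀ P → InU F x P → InMus F x (FP x P))
      × (∀ F' → InMus F x F' → ∃ λ P → InU F x P × FP x P ≐ᶜ F'))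
    -- 2. singleton preimages
  × (∀ F' → InMus F x F' → PreimageIsOne F x F' ⇔ TwoUnits F')
  × (∀ P → InU F x P → TwoUnits (FP x P) ⇔ FinalArcUnit P)
  × (∀ P ws a → InU F x P → P ≡ ws ++ (a ∷ compl a ∷ []) →
        UnitsAre (FP x P) x (compl a)
      × IsPath F (ws ∷ʳ a) × StartsAt x (ws ∷ʳ a)
      × Last (ws ∷ʳ a) (compl (compl a)) × Regular (ws ∷ʳ a))
    -- 3. two-element preimages
  × (∀ F' → InMus F x F' → OneUnit F' x → PreimageHasTwo F x F')
  × (∀ F' P → InMus F x F' → OneUnit F' x → InU F x P → FP x P ≐ᶜ F' →
        (Last P (compl x) →
            pathLength P ≥ 2 × FamilyIIa F' x × contra P ≢ P
          × InU F x (contra P) × FP x (contra P) ≐ᶜ FP x P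
          × PreimageIsPair F x F' P (contra P))
      × (¬ Last P (compl x) →
            FamilyIIb F' x
          × (∀ P0 P1 → RegDecomp P P0 P1 →
                (P0 ⨾ contra P1) ≢ P × PreimageIsPair F x F' P (P0 ⨾ contra P1))))
theorem6p4 F x h12 x∈F =
  ((λ _ → FP∈mus x∈F) , (λ _ → mus⇒FP-preimage h12)) ,
  (λ _ → preimage-one⇔two-units h12) ,
  (λ _ → two-units⇔final-arc-unit) ,
  (λ _ _ _ inU → final-arc-unit-structure (InU⇒Decomposition inU) (proj₁ inU)) ,
  (λ _ → one-unit⇒preimage-two h12) ,
  λ _ _ mus one inU e → ending-at-compl-x h12 mus one inU e , not-ending-at-compl-x h12 mus one inU e
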